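{- Let $W$ be a Weyl group of type $D_n$, $n\ge 4$, with simple reflections $S=\{s_0,s_1,\dots,s_{n-1}\}$ labeled so that $s_0$ and $s_1$ are each joined to $s_2$ and $s_2-s_3-\cdots-s_{n-1}$ is a path. Let $J=S\setminus\{s_{n-1}\}$. Then every palindromic element $v\in W^J$ is a locally-longest element.
   Context: $W_K$ is the parabolic subgroup generated by $K\subseteq S$; $W^K$ is the set of minimal length representatives of $W/W_K$ with induced Bruhat order. $v\in W^J$ is palindromic if $\sum_{z\in W^J,z\le v}q^{\ell(z)}$ is a palindromic polynomial of degree $\ell(v)$. With $I$ the set of simple reflections in a reduced word of $v$, $v$ is locally-longest if $I$ is connected in the Dynkin diagram and $v$ is the longest element of $W_I^{I\cap J}$. -}

module Defs where

open import Data.Nat using (ℕ; zero; suc; _≤_; _<_; _∸_; _≡ᵇ_)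
open import Data.Integer using (ℤ; +_; -_)
open import Data.Bool using (if_then_else_)
open import Data.Fin using (Fin; toℕ)
open import Data.Vec using (Vec; []; _∷_; tabulate)
open import Data.List using (List; []; _∷_; _++_; length; foldr)
open import Data.List.Relation.Unary.All using (All)
open import Data.List.Relation.Unary.Any using (Any)
open import Data.List.Relation.Unary.AllPairs using (AllPairs)
open import Data.List.Relation.Binary.Sublist.Propositional using (_⊆_)
open import Data.List.Membership.Propositional using (_∈_)
open import Data.Product using (Σ; _×_)
open import Data.Sum using (_⊎_)
open import Relation.Binary.PropositionalEquality using (_≡_; _≢_)
open import Relation.Nullary using (¬_)

-- The Weyl group D_n, realised faithfully as signed permutations with
-- an even number of sign changes acting on ℤ^n.
-- Generators are indexed by Fin n:  s_0, s_1, ..., s_{n-1}.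
--   s_0 : (x_0, x_1, ...) ↦ (-x_1, -x_0, ...)
--   s_k (k ≥ 1) : swaps coordinates k-1 and k  (0-indexed)
-- Dynkin diagram: s_0 - s_2, s_1 - s_2, s_2 - s_3 - ... - s_{n-1}.
-- An element is given by a word (List (Fin n)); the word
-- i_1 i_2 ... i_k denotes the product s_{i_1} s_{i_2} ... s_{i_k}, and
-- concatenation of words is multiplication in W.

look : ∀ {n} → Vec ℤ n → ℕ → ℤ
look [] _ = + 0
look (x ∷ xs) zero = x
look (x ∷ xs) (suc i) = look xs i

genℕ : ∀ {n} → ℕ → Vec ℤ n → ℕ → ℤ
genℕ zero x p =
  if p ≡ᵇ 0 then - look x 1 else
  if p ≡ᵇ 1 then - look x 0 else look x p
genℕ (suc k) x p =
  if p ≡ᵇ k then look x (suc k) else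
  if p ≡ᵇ suc k then look x k else look x p

gen : ∀ {n} → Fin n → Vec ℤ n → Vec ℤ n
gen k x = tabulate (λ p → genℕ (toℕ k) x (toℕ p))

Word : ℕ → Set
Word n = List (Fin n)

-- base point with trivial stabiliser: (1, 2, ..., n)
base : ∀ n → Vec ℤ n
base n = tabulate (λ (p : Fin n) → + suc (toℕ p))

⟦_⟧ : ∀ {n} → Word n → Vec ℤ n
⟦_⟧ {n} w = foldr gen (base n) w

_≈W_ : ∀ {n} → Word n → Word n → Set
u ≈W v = ⟦ u ⟧ ≡ ⟦ v ⟧

Len : ∀ {n} → Word n → ℕ → Set
Len {n} w k =
  (Σ (Word n) λ r → (r ≈W w) × (length r ≡ k)) ×
  (∀ (r : Word n) → r ≈W w → k ≤ length r)

Reduced : ∀ {n} → Word n → Set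
Reduced {n} r = ∀ (r' : Word n) → r' ≈W r → length r ≤ length r'

-- Bruhat order (subword property): u ≤ v iff some reduced word for v
-- has a subword that is a word for u
Bruhat : ∀ {n} → Word n → Word n → Set
Bruhat {n} u v =
  Σ (Word n) λ r → (r ≈W v) × Reduced r ×
    (Σ (Word n) λ t → (t ⊆ r) × (t ≈W u))

-- v is a minimal length representative of v W_K, i.e. v ∈ W^K
MinRep : ∀ {n} → (Fin n → Set) → Word n → Set
MinRep {n} K v =
  ∀ (x : Word n) → All K x → ∀ a b → Len v a → Len (v ++ x) b → a ≤ b

InParabolic : ∀ {n} → (Fin n → Set) → Word n → Set
InParabolic {n} I u = Σ (Word n) λ x → All I x × (x ≈W u)

Jset : ∀ n → Fin n → Set
Jset n i = toℕ i ≢ n ∸ 1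

-- number of elements of W satisfying P (P must respect ≈W)
Count : ∀ {n} → (Word n → Set) → ℕ → Set
Count {n} P c =
  Σ (List (Word n)) λ L →
    (length L ≡ c) × All P L × AllPairs (λ a b → ¬ (a ≈W b)) L ×
    (∀ (z : Word n) → P z → Any (λ y → y ≈W z) L)

-- the set {z ∈ W^J : z ≤ v, ℓ(z) = i}: its size is the coefficient of q^i
Coeff : ∀ {n} → Word n → ℕ → Word n → Set
Coeff {n} v i z = MinRep (Jset n) z × Bruhat z v × Len z i

-- Σ_{z ∈ W^J, z ≤ v} q^{ℓ(z)} is palindromic of degree ℓ(v)
Palindromic : ∀ {n} → Word n → Set
Palindromic {n} v =
  Σ ℕ λ d → Len v d ×
    (∀ i → i ≤ d → Σ ℕ λ c → Count (Coeff v i) c × Count (Coeff v (d ∸ i)) c) ×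
    (∀ i → d < i → Count (Coeff v i) 0) ×
    (Σ ℕ λ c → 1 ≤ c × Count (Coeff v d) c)

Adjℕ : ℕ → ℕ → Set
Adjℕ a b = (a ≡ 0 × b ≡ 2) ⊎ (a ≡ 1 × b ≡ 2) ⊎ (2 ≤ a × b ≡ suc a)

Adj : ∀ {n} → Fin n → Fin n → Set
Adj i j = Adjℕ (toℕ i) (toℕ j) ⊎ Adjℕ (toℕ j) (toℕ i)

data PathIn {n} (I : Fin n → Set) : Fin n → Fin n → Set where
  here : ∀ {i} → PathIn I i i
  step : ∀ {i k j} → Adj i k → I k → PathIn I k j → PathIn I i j

Connected : ∀ {n} → (Fin n → Set) → Set
Connected {n} I = ∀ (i j : Fin n) → I i → I j → PathIn I i j

LocallyLongest : ∀ {n} → (Fin n → Set) → Word n → Set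
LocallyLongest {n} J v =
  ∀ (r : Word n) → r ≈W v → Reduced r →
    Connected (λ i → i ∈ r) ×
    InParabolic (λ i → i ∈ r) v ×
    MinRep (λ i → (i ∈ r) × J i) v ×
    (∀ (u : Word n) → InParabolic (λ i → i ∈ r) u →
       MinRep (λ i → (i ∈ r) × J i) u →
       ∀ a b → Len u a → Len v b → a ≤ b)

module Submission where

-- W = D_n acts on ℤ^n by signed permutations of the coordinates 0, …, N (N = n − 1), and W_J is the
-- stabiliser of coordinate N. So the cosets wW_J correspond to the 2n signed positions ±e_p, graded by
-- rank (+e_p) = N − p and rank (−e_p) = N + p, with canonical words chain p = s_{p+1} ⋯ s_N and
-- negChain p = s_p ⋯ s_1 s_0 s_2 ⋯ s_N of that length. An exchange lemma rewrites s_k · rep q as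
-- rep (s_k q) · y with y ∈ W_J, so every word is rep (coset w) · y; hence ℓ = rank on W^J, and an element
-- of W_I^{I∩J} is no longer than the largest rank reachable from e_N with letters of I. A word of length
-- equal to its rank is rigid: it is chain p, or s_0 · chain 1, or ends with s_b s_a · chain 1 where
-- {a, b} = {0, 1}. In the first two cases and for the top element −e_N the support of v is connected and v
-- is longest in W_I^{I∩J}. For −e_p with 0 < p < N, W^J has one element of each length below N, but
-- s_0 · chain 1 and s_1 · chain 1 both lie below v in length N, so the coefficients of q^p and q^N differ.

open import Defs
open import Data.Bool using (Bool; true; false; if_then_else_; _xor_)
open import Data.Empty using (⊥; ⊥-elim)
open import Data.Integer using (ℤ; +_; -_)
import Data.Integer.Properties as ℤ
open import Data.Fin using (Fin; toℕ; fromℕ<)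
open import Data.Fin.Properties using (toℕ<n; toℕ-fromℕ<; toℕ-injective)
open import Data.List using (List; []; _∷_; _++_; [_]; length; foldr; map; reverse)
open import Data.List.Properties using (∷-injective; ++-identityʳ; ++-assoc; map-++; length-map; map-injective; unfold-reverse; reverse-map; foldr-++)
open import Data.List.Relation.Unary.All as All using (All; []; _∷_)
import Data.List.Relation.Unary.All.Properties as All
open import Data.List.Relation.Unary.Any using (here; there)
import Data.List.Relation.Unary.Any.Properties as Any
open import Data.List.Relation.Unary.AllPairs using ([]; _∷_)
open import Data.List.Membership.Propositional using (_∈_)
open import Data.List.Membership.Propositional.Properties using (∈-map⁺; ∈-map⁻; ∈-++⁺ʳ)
open import Data.List.Relation.Binary.Sublist.Propositional using (_⊆_; _∷_; _∷ʳ_; ⊆-refl)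
open import Data.List.Relation.Binary.Sublist.Propositional.Properties using (++⁺ˡ)
open import Data.Nat using (ℕ; zero; suc; _≤_; _<_; _∸_; _≡ᵇ_; _+_; z≤n; s≤s; _≤?_)
open import Data.Nat.Properties
open import Data.Product using (Σ; _×_; _,_; proj₁; proj₂)
open import Data.Sum as Sum using (_⊎_; inj₁; inj₂)
open import Function using (id; _∘′_)
open import Data.Vec using (Vec; []; _∷_; tabulate)
open import Relation.Binary.PropositionalEquality hiding ([_])
open import Relation.Nullary using (¬_; yes; no)

-- Signed permutations

negateIf : Bool → ℤ → ℤ
negateIf true  z = - z
negateIf false z = z

negateIf-xor : ∀ a b z → negateIf a (negateIf b z) ≡ negateIf (a xor b) z
negateIf-xor true  true  z = ℤ.neg-involutive z
negateIf-xor true  false z = refl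
negateIf-xor false b     z = refl

-- The generator of index k writes into coordinate p the entry at coordinate pos k p, negated iff neg k p.
pos : ℕ → ℕ → ℕ
pos zero    zero          = 1
pos zero    (suc zero)    = 0
pos zero    (suc (suc p)) = suc (suc p)
pos (suc k) p = if p ≡ᵇ k then suc k else (if p ≡ᵇ suc k then k else p)

neg : ℕ → ℕ → Bool
neg zero    zero          = true
neg zero    (suc zero)    = true
neg zero    (suc (suc p)) = false
neg (suc k) p             = false

look-if : ∀ {m} (x : Vec ℤ m) b a c → look x (if b then a else c) ≡ (if b then look x a else look x c)
look-if x true  a c = refl
look-if x false a c = refl

genℕ≡negateIf-look : ∀ {m} k (x : Vec ℤ m) p → genℕ k x p ≡ negateIf (neg k p) (look x (pos k p))
genℕ≡negateIf-look zero    x zero          = refl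
genℕ≡negateIf-look zero    x (suc zero)    = refl
genℕ≡negateIf-look zero    x (suc (suc p)) = refl
genℕ≡negateIf-look (suc k) x p = sym (begin
  look x (pos (suc k) p)
    ≡⟨ look-if x (p ≡ᵇ k) (suc k) _ ⟩
  (if p ≡ᵇ k then look x (suc k) else look x (if p ≡ᵇ suc k then k else p))
    ≡⟨ cong (if p ≡ᵇ k then look x (suc k) else_) (look-if x (p ≡ᵇ suc k) k p) ⟩
  genℕ (suc k) x p ∎)
  where open ≡-Reasoning

look-tabulate : ∀ m (g : ℕ → ℤ) p → p < m → look (tabulate {n = m} (λ q → g (toℕ q))) p ≡ g p
look-tabulate (suc m) g zero    _       = refl
look-tabulate (suc m) g (suc p) (s≤s h) = look-tabulate m (λ q → g (suc q)) p h

look-extensional : ∀ {m} (x y : Vec ℤ m) → (∀ p → p < m → look x p ≡ look y p) → x ≡ y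
look-extensional []      []      h = refl
look-extensional (a ∷ x) (b ∷ y) h =
  cong₂ _∷_ (h 0 (s≤s z≤n)) (look-extensional x y (λ p p<m → h (suc p) (s≤s p<m)))

look-base : ∀ m p → p < m → look (base m) p ≡ + suc p
look-base m = look-tabulate m (λ q → + suc q)

act₁ : ∀ {m} → ℕ → Vec ℤ m → Vec ℤ m
act₁ k x = tabulate (λ q → genℕ k x (toℕ q))

act : ∀ {m} → List ℕ → Vec ℤ m → Vec ℤ m
act []      x = x
act (k ∷ w) x = act₁ k (act w x)

act-++ : ∀ {m} a b (x : Vec ℤ m) → act (a ++ b) x ≡ act a (act b x)
act-++ []      b x = refl
act-++ (k ∷ a) b x = cong (act₁ k) (act-++ a b x)

⟦⟧≡act : ∀ {m} (w : Word m) → ⟦ w ⟧ ≡ act (map toℕ w) (base m)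
⟦⟧≡act []      = refl
⟦⟧≡act (k ∷ w) = cong (act₁ (toℕ k)) (⟦⟧≡act w)

word-pos : List ℕ → ℕ → ℕ
word-pos []      p = p
word-pos (k ∷ w) p = word-pos w (pos k p)

word-neg : List ℕ → ℕ → Bool
word-neg []      p = false
word-neg (k ∷ w) p = neg k p xor word-neg w (pos k p)

≡ᵇ-refl : ∀ m → (m ≡ᵇ m) ≡ true
≡ᵇ-refl zero    = refl
≡ᵇ-refl (suc m) = ≡ᵇ-refl m

≢⇒≡ᵇ-false : ∀ {m k} → m ≢ k → (m ≡ᵇ k) ≡ false
≢⇒≡ᵇ-false {zero}  {zero}  m≢k = ⊥-elim (m≢k refl)
≢⇒≡ᵇ-false {zero}  {suc k} m≢k = refl
≢⇒≡ᵇ-false {suc m} {zero}  m≢k = refl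
≢⇒≡ᵇ-false {suc m} {suc k} m≢k = ≢⇒≡ᵇ-false (m≢k ∘′ cong suc)

pos-suc-self : ∀ j → pos (suc j) j ≡ suc j
pos-suc-self j rewrite ≡ᵇ-refl j = refl

pos-suc-suc : ∀ j → pos (suc j) (suc j) ≡ j
pos-suc-suc j rewrite ≢⇒≡ᵇ-false {suc j} {j} (λ ()) | ≡ᵇ-refl j = refl

pos-suc-other : ∀ j p → p ≢ j → p ≢ suc j → pos (suc j) p ≡ p
pos-suc-other j p p≢j p≢sj rewrite ≢⇒≡ᵇ-false p≢j | ≢⇒≡ᵇ-false p≢sj = refl

pos-0-other : ∀ p → 2 ≤ p → pos 0 p ≡ p
pos-0-other (suc (suc p)) _         = refl
pos-0-other (suc zero)    (s≤s ())

neg-0-other : ∀ p → 2 ≤ p → neg 0 p ≡ false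
neg-0-other (suc (suc p)) _         = refl
neg-0-other (suc zero)    (s≤s ())

pos-suc-≥2 : ∀ j p → 2 ≤ j → 2 ≤ p → 2 ≤ pos (suc j) p
pos-suc-≥2 j p 2≤j 2≤p with p ≡ᵇ j
... | true  = ≤-trans 2≤j (n≤1+n j)
... | false with p ≡ᵇ suc j
...   | true  = 2≤j
...   | false = 2≤p

pos-involutive : ∀ k p → pos k (pos k p) ≡ p
pos-involutive zero zero          = refl
pos-involutive zero (suc zero)    = refl
pos-involutive zero (suc (suc p)) = refl
pos-involutive (suc k) p with p ≟ k
... | yes refl = trans (cong (pos (suc p)) (pos-suc-self p)) (pos-suc-suc p)
... | no p≢k with p ≟ suc k
...   | yes refl = trans (cong (pos (suc k)) (pos-suc-suc k)) (pos-suc-self k)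
...   | no p≢sk  = trans (cong (pos (suc k)) (pos-suc-other k p p≢k p≢sk)) (pos-suc-other k p p≢k p≢sk)

pos-< : ∀ {m} k p → 2 ≤ m → k < m → p < m → pos k p < m
pos-< zero    zero          2≤m k<m p<m = 2≤m
pos-< zero    (suc zero)    2≤m k<m p<m = k<m
pos-< zero    (suc (suc p)) 2≤m k<m p<m = p<m
pos-< (suc j) p             2≤m k<m p<m with p ≡ᵇ j
... | true  = k<m
... | false with p ≡ᵇ suc j
...   | true  = <-trans (n<1+n j) k<m
...   | false = p<m

word-pos-< : ∀ {m} w p → 2 ≤ m → All (_< m) w → p < m → word-pos w p < m
word-pos-< []      p 2≤m []           p<m = p<m
word-pos-< (k ∷ w) p 2≤m (k<m ∷ w<m) p<m = word-pos-< w (pos k p) 2≤m w<m (pos-< k p 2≤m k<m p<m)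

look-act : ∀ {m} w (x : Vec ℤ m) p → 2 ≤ m → All (_< m) w → p < m →
  look (act w x) p ≡ negateIf (word-neg w p) (look x (word-pos w p))
look-act []      x p 2≤m []           p<m = refl
look-act {m} (k ∷ w) x p 2≤m (k<m ∷ w<m) p<m = begin
  look (act₁ k (act w x)) p
    ≡⟨ look-tabulate m (genℕ k (act w x)) p p<m ⟩
  genℕ k (act w x) p
    ≡⟨ genℕ≡negateIf-look k (act w x) p ⟩
  negateIf (neg k p) (look (act w x) (pos k p))
    ≡⟨ cong (negateIf (neg k p)) (look-act w x (pos k p) 2≤m w<m (pos-< k p 2≤m k<m p<m)) ⟩
  negateIf (neg k p) (negateIf (word-neg w (pos k p)) (look x (word-pos w (pos k p))))
    ≡⟨ negateIf-xor (neg k p) (word-neg w (pos k p)) _ ⟩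
  negateIf (word-neg (k ∷ w) p) (look x (word-pos (k ∷ w) p)) ∎
  where open ≡-Reasoning

negateIf-suc-injective : ∀ s t i j → negateIf s (+ suc i) ≡ negateIf t (+ suc j) → (s ≡ t) × (i ≡ j)
negateIf-suc-injective true  true  i j e = refl , suc-injective (ℤ.+-injective (ℤ.neg-injective e))
negateIf-suc-injective true  false i j ()
negateIf-suc-injective false true  i j ()
negateIf-suc-injective false false i j refl = refl , refl

record ActEq (m : ℕ) (a b : List ℕ) : Set where
  constructor act-eq
  field act-≡ : ∀ (x : Vec ℤ m) → act a x ≡ act b x
open ActEq

module _ {m : ℕ} where

  infixr 5 _⟫_

  ≋-reflexive : ∀ {a b} → a ≡ b → ActEq m a b
  ≋-reflexive refl = act-eq λ _ → refl

  ≋-sym : ∀ {a b} → ActEq m a b → ActEq m b a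
  ≋-sym a≋b = act-eq λ x → sym (act-≡ a≋b x)

  _⟫_ : ∀ {a b c} → ActEq m a b → ActEq m b c → ActEq m a c
  a≋b ⟫ b≋c = act-eq λ x → trans (act-≡ a≋b x) (act-≡ b≋c x)

  ≋-congˡ : ∀ {a b} c → ActEq m a b → ActEq m (c ++ a) (c ++ b)
  ≋-congˡ {a} {b} c a≋b = act-eq λ x → begin
    act (c ++ a) x    ≡⟨ act-++ c a x ⟩
    act c (act a x)   ≡⟨ cong (act c) (act-≡ a≋b x) ⟩
    act c (act b x)   ≡⟨ act-++ c b x ⟨
    act (c ++ b) x    ∎
    where open ≡-Reasoning

  ≋-congʳ : ∀ {a b} d → ActEq m a b → ActEq m (a ++ d) (b ++ d)
  ≋-congʳ {a} {b} d a≋b = act-eq λ x → begin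
    act (a ++ d) x    ≡⟨ act-++ a d x ⟩
    act a (act d x)   ≡⟨ act-≡ a≋b (act d x) ⟩
    act b (act d x)   ≡⟨ act-++ b d x ⟨
    act (b ++ d) x    ∎
    where open ≡-Reasoning

  ≋-++-[] : ∀ a → ActEq m a (a ++ [])
  ≋-++-[] a = ≋-reflexive (sym (++-identityʳ a))

module _ {m : ℕ} (2≤m : 2 ≤ m) {a b : List ℕ} (a<m : All (_< m) a) (b<m : All (_< m) b) where

  ActEq-from-pos-neg : (∀ p → p < m → word-pos a p ≡ word-pos b p) →
    (∀ p → p < m → word-neg a p ≡ word-neg b p) → ActEq m a b
  ActEq-from-pos-neg pos≡ neg≡ = act-eq λ x → look-extensional _ _ λ p p<m → begin
    look (act a x) p                                         ≡⟨ look-act a x p 2≤m a<m p<m ⟩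
    negateIf (word-neg a p) (look x (word-pos a p))          ≡⟨ cong₂ (λ s q → negateIf s (look x q)) (neg≡ p p<m) (pos≡ p p<m) ⟩
    negateIf (word-neg b p) (look x (word-pos b p))          ≡⟨ look-act b x p 2≤m b<m p<m ⟨
    look (act b x) p ∎
    where open ≡-Reasoning

  -- The base point has distinct nonzero entries, so its image records every position and sign.
  act-base-injective : act a (base m) ≡ act b (base m) → ∀ p → p < m →
    (word-pos a p ≡ word-pos b p) × (word-neg a p ≡ word-neg b p)
  act-base-injective e p p<m with negateIf-suc-injective _ _ _ _ (begin
      negateIf (word-neg a p) (+ suc (word-pos a p))
        ≡⟨ cong (negateIf (word-neg a p)) (look-base m _ (word-pos-< a p 2≤m a<m p<m)) ⟨
      negateIf (word-neg a p) (look (base m) (word-pos a p))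
        ≡⟨ look-act a (base m) p 2≤m a<m p<m ⟨
      look (act a (base m)) p
        ≡⟨ cong (λ y → look y p) e ⟩
      look (act b (base m)) p
        ≡⟨ look-act b (base m) p 2≤m b<m p<m ⟩
      negateIf (word-neg b p) (look (base m) (word-pos b p))
        ≡⟨ cong (negateIf (word-neg b p)) (look-base m _ (word-pos-< b p 2≤m b<m p<m)) ⟩
      negateIf (word-neg b p) (+ suc (word-pos b p)) ∎)
    where open ≡-Reasoning
  ... | neg≡ , pos≡ = pos≡ , neg≡

  ActEq-from-base : act a (base m) ≡ act b (base m) → ActEq m a b
  ActEq-from-base e = ActEq-from-pos-neg (λ p p<m → proj₁ (act-base-injective e p p<m))
                                          (λ p p<m → proj₂ (act-base-injective e p p<m))

module CoxeterRelations {m : ℕ} (2≤m : 2 ≤ m) where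

  0<m : 0 < m
  0<m = <-trans (s≤s z≤n) 2≤m

  gen-involutive : ∀ k → k < m → ActEq m (k ∷ k ∷ []) []
  gen-involutive k k<m = ActEq-from-pos-neg 2≤m (k<m ∷ k<m ∷ []) [] (λ p _ → pos-involutive k p) (λ p _ → neg-twice k p)
    where
    neg-twice : ∀ k p → word-neg (k ∷ k ∷ []) p ≡ false
    neg-twice zero    zero          = refl
    neg-twice zero    (suc zero)    = refl
    neg-twice zero    (suc (suc p)) = refl
    neg-twice (suc k) p             = refl

  swaps-commute : ∀ i j → suc i < j → suc j < m → ActEq m (suc i ∷ suc j ∷ []) (suc j ∷ suc i ∷ [])
  swaps-commute i j i+1<j sj<m =
    ActEq-from-pos-neg 2≤m (si<m ∷ sj<m ∷ []) (sj<m ∷ si<m ∷ []) (λ p _ → sym (pos-commute p)) (λ p _ → refl)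
    where
    si<m : suc i < m
    si<m = <-trans i+1<j (<-trans (n<1+n j) sj<m)
    i≢j : i ≢ j
    i≢j = <⇒≢ (<-trans (n<1+n i) i+1<j)
    i≢sj : i ≢ suc j
    i≢sj = <⇒≢ (<-trans (n<1+n i) (<-trans i+1<j (n<1+n j)))
    si≢j : suc i ≢ j
    si≢j = <⇒≢ i+1<j
    si≢sj : suc i ≢ suc j
    si≢sj = <⇒≢ (<-trans i+1<j (n<1+n j))
    pos-commute : ∀ p → pos (suc i) (pos (suc j) p) ≡ pos (suc j) (pos (suc i) p)
    pos-commute p with p ≟ i
    ... | yes refl rewrite pos-suc-other j i i≢j i≢sj | pos-suc-self i | pos-suc-other j (suc i) si≢j si≢sj = refl
    ... | no p≢i with p ≟ suc i
    ... | yes refl rewrite pos-suc-other j (suc i) si≢j si≢sj | pos-suc-suc i | pos-suc-other j i i≢j i≢sj = refl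
    ... | no p≢si with p ≟ j
    ... | yes refl rewrite pos-suc-self j | pos-suc-other i j p≢i p≢si | pos-suc-self j
                         | pos-suc-other i (suc j) (≢-sym i≢sj) (≢-sym si≢sj) = refl
    ... | no p≢j with p ≟ suc j
    ... | yes refl rewrite pos-suc-suc j | pos-suc-other i (suc j) p≢i p≢si | pos-suc-suc j
                         | pos-suc-other i j (≢-sym i≢j) (≢-sym si≢j) = refl
    ... | no p≢sj rewrite pos-suc-other j p p≢j p≢sj | pos-suc-other i p p≢i p≢si | pos-suc-other j p p≢j p≢sj = refl

  gen0-swap-commute : ∀ j → 2 ≤ j → suc j < m → ActEq m (0 ∷ suc j ∷ []) (suc j ∷ 0 ∷ [])
  gen0-swap-commute j 2≤j sj<m = ActEq-from-pos-neg 2≤m (0<m ∷ sj<m ∷ []) (sj<m ∷ 0<m ∷ []) pos-commute neg-commute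
    where
    0≢j : 0 ≢ j
    0≢j = <⇒≢ (<-trans (s≤s z≤n) 2≤j)
    1≢j : 1 ≢ j
    1≢j = <⇒≢ 2≤j
    pos-fix-0 : pos (suc j) 0 ≡ 0
    pos-fix-0 = pos-suc-other j 0 0≢j (λ ())
    pos-fix-1 : pos (suc j) 1 ≡ 1
    pos-fix-1 = pos-suc-other j 1 1≢j (0≢j ∘′ suc-injective)
    pos-commute : ∀ p → p < m → pos (suc j) (pos 0 p) ≡ pos 0 (pos (suc j) p)
    pos-commute zero          _ rewrite pos-fix-0 | pos-fix-1 = refl
    pos-commute (suc zero)    _ rewrite pos-fix-0 | pos-fix-1 = refl
    pos-commute (suc (suc p)) _ = sym (pos-0-other _ (pos-suc-≥2 j (suc (suc p)) 2≤j (s≤s (s≤s z≤n))))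
    neg-commute : ∀ p → p < m → (neg 0 p xor (false xor false)) ≡ (false xor (neg 0 (pos (suc j) p) xor false))
    neg-commute zero          _ rewrite pos-fix-0 = refl
    neg-commute (suc zero)    _ rewrite pos-fix-1 = refl
    neg-commute (suc (suc p)) _ rewrite neg-0-other _ (pos-suc-≥2 j (suc (suc p)) 2≤j (s≤s (s≤s z≤n))) = refl

  gen0-gen1-commute : 1 < m → ActEq m (0 ∷ 1 ∷ []) (1 ∷ 0 ∷ [])
  gen0-gen1-commute 1<m = ActEq-from-pos-neg 2≤m (0<m ∷ 1<m ∷ []) (1<m ∷ 0<m ∷ []) pos-commute neg-commute
    where
    pos-commute : ∀ p → p < m → word-pos (0 ∷ 1 ∷ []) p ≡ word-pos (1 ∷ 0 ∷ []) p
    pos-commute zero          _ = refl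
    pos-commute (suc zero)    _ = refl
    pos-commute (suc (suc p)) _ = refl
    neg-commute : ∀ p → p < m → word-neg (0 ∷ 1 ∷ []) p ≡ word-neg (1 ∷ 0 ∷ []) p
    neg-commute zero          _ = refl
    neg-commute (suc zero)    _ = refl
    neg-commute (suc (suc p)) _ = refl

  swaps-braid : ∀ j → suc (suc j) < m →
    ActEq m (suc j ∷ suc (suc j) ∷ suc j ∷ []) (suc (suc j) ∷ suc j ∷ suc (suc j) ∷ [])
  swaps-braid j ssj<m = ActEq-from-pos-neg 2≤m (sj<m ∷ ssj<m ∷ sj<m ∷ []) (ssj<m ∷ sj<m ∷ ssj<m ∷ []) pos-braid (λ p _ → refl)
    where
    sj<m : suc j < m
    sj<m = <-trans (n<1+n _) ssj<m
    pos-braid : ∀ p → p < m →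
      pos (suc j) (pos (suc (suc j)) (pos (suc j) p)) ≡ pos (suc (suc j)) (pos (suc j) (pos (suc (suc j)) p))
    pos-braid p _ with p ≟ j
    ... | yes refl rewrite pos-suc-self p | pos-suc-self (suc p) | pos-suc-other p (suc (suc p)) (λ ()) (λ ())
                         | pos-suc-other (suc p) p (λ ()) (λ ()) | pos-suc-self p | pos-suc-self (suc p) = refl
    ... | no p≢j with p ≟ suc j
    ... | yes refl rewrite pos-suc-suc j | pos-suc-other (suc j) j (λ ()) (λ ()) | pos-suc-self j
                         | pos-suc-self (suc j) | pos-suc-other j (suc (suc j)) (λ ()) (λ ()) | pos-suc-suc (suc j) = refl
    ... | no p≢sj with p ≟ suc (suc j)
    ... | yes refl rewrite pos-suc-other j (suc (suc j)) (λ ()) (λ ()) | pos-suc-suc (suc j) | pos-suc-suc j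
                         | pos-suc-other (suc j) j (λ ()) (λ ()) = refl
    ... | no p≢ssj rewrite pos-suc-other j p p≢j p≢sj | pos-suc-other (suc j) p p≢sj p≢ssj
                         | pos-suc-other j p p≢j p≢sj = sym (pos-suc-other (suc j) p p≢sj p≢ssj)

  gen0-gen2-braid : 2 < m → ActEq m (0 ∷ 2 ∷ 0 ∷ []) (2 ∷ 0 ∷ 2 ∷ [])
  gen0-gen2-braid 2<m = ActEq-from-pos-neg 2≤m (0<m ∷ 2<m ∷ 0<m ∷ []) (2<m ∷ 0<m ∷ 2<m ∷ []) pos-braid neg-braid
    where
    pos-braid : ∀ p → p < m → word-pos (0 ∷ 2 ∷ 0 ∷ []) p ≡ word-pos (2 ∷ 0 ∷ 2 ∷ []) p
    pos-braid zero                _ = refl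
    pos-braid (suc zero)          _ = refl
    pos-braid (suc (suc zero))    _ = refl
    pos-braid (suc (suc (suc p))) _ = refl
    neg-braid : ∀ p → p < m → word-neg (0 ∷ 2 ∷ 0 ∷ []) p ≡ word-neg (2 ∷ 0 ∷ 2 ∷ []) p
    neg-braid zero                _ = refl
    neg-braid (suc zero)          _ = refl
    neg-braid (suc (suc zero))    _ = refl
    neg-braid (suc (suc (suc p))) _ = refl

∸≡suc∸suc : ∀ m n → n < m → m ∸ n ≡ suc (m ∸ suc n)
∸≡suc∸suc (suc m) zero    _         = refl
∸≡suc∸suc (suc m) (suc n) (s≤s n<m) = ∸≡suc∸suc m n n<m

m∸n≤1+m∸[1+n] : ∀ m n → m ∸ n ≤ suc (m ∸ suc n)
m∸n≤1+m∸[1+n] zero    n       = ≤-trans (≤-reflexive (0∸n≡0 n)) z≤n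
m∸n≤1+m∸[1+n] (suc m) zero    = ≤-refl
m∸n≤1+m∸[1+n] (suc m) (suc n) = m∸n≤1+m∸[1+n] m n

1+[m∸o]≡m∸n⇒o≡1+n : ∀ m n o → n ≤ m → o ≤ m → suc (m ∸ o) ≡ m ∸ n → o ≡ suc n
1+[m∸o]≡m∸n⇒o≡1+n m n o n≤m o≤m e = begin
  o                      ≡⟨ m∸[m∸n]≡n o≤m ⟨
  m ∸ (m ∸ o)            ≡⟨ ∸≡suc∸suc m (m ∸ o) (subst (_≤ m) (sym e) (m∸n≤m m n)) ⟩
  suc (m ∸ suc (m ∸ o))  ≡⟨ cong (λ z → suc (m ∸ z)) e ⟩
  suc (m ∸ (m ∸ n))      ≡⟨ cong suc (m∸[m∸n]≡n n≤m) ⟩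
  suc n                  ∎
  where open ≡-Reasoning

ascending : ℕ → ℕ → List ℕ
ascending a zero    = []
ascending a (suc k) = a ∷ ascending (suc a) k

∈-ascending⁻ : ∀ a k {j} → j ∈ ascending a k → (a ≤ j) × (j < a + k)
∈-ascending⁻ a (suc k) (here refl) = ≤-refl , m<m+n a (s≤s z≤n)
∈-ascending⁻ a (suc k) {j} (there j∈) with ∈-ascending⁻ (suc a) k j∈
... | a<j , j<a+1+k = <⇒≤ a<j , subst (j <_) (sym (+-suc a k)) j<a+1+k

∈-ascending⁺ : ∀ a k {j} → a ≤ j → j < a + k → j ∈ ascending a k
∈-ascending⁺ a zero    {j} a≤j j<a+0 = ⊥-elim (<-irrefl refl (≤-<-trans a≤j (subst (j <_) (+-identityʳ a) j<a+0)))
∈-ascending⁺ a (suc k) {j} a≤j j<a+k with a ≟ j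
... | yes refl = here refl
... | no a≢j   = there (∈-ascending⁺ (suc a) k (≤∧≢⇒< a≤j a≢j) (subst (j <_) (+-suc a k) j<a+k))

length-ascending : ∀ a k → length (ascending a k) ≡ k
length-ascending a zero    = refl
length-ascending a (suc k) = cong suc (length-ascending (suc a) k)

All-reverse : ∀ {A : Set} {Q : A → Set} {xs} → All Q xs → All Q (reverse xs)
All-reverse Qxs = All.tabulate λ x∈ → All.lookup Qxs (Any.reverse⁻ x∈)

-- Paths in the Dynkin diagram

_++ᴾ_ : ∀ {m} {I : Fin m → Set} {i k j} → PathIn I i k → PathIn I k j → PathIn I i j
here               ++ᴾ q = q
step adj Ik p ++ᴾ q = step adj Ik (p ++ᴾ q)

path-reverse : ∀ {m} {I : Fin m → Set} {i j} → I i → PathIn I i j → PathIn I j i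
path-reverse Ii here            = here
path-reverse Ii (step adj Ik p) = path-reverse Ik p ++ᴾ step (Sum.swap adj) Ii here

Adjℕ-suc : ∀ a → 1 ≤ a → Adjℕ a (suc a)
Adjℕ-suc (suc zero)    _ = inj₂ (inj₁ (refl , refl))
Adjℕ-suc (suc (suc a)) _ = inj₂ (inj₂ (s≤s (s≤s z≤n) , refl))

module Interval {m} (I : Fin m → Set) (lo : ℕ) (1≤lo : 1 ≤ lo) (I-above : ∀ i → lo ≤ toℕ i → I i) where

  path-up : ∀ g (i j : Fin m) → lo ≤ toℕ i → toℕ j ≡ toℕ i + g → PathIn I i j
  path-up zero    i j _    j≡ = subst (PathIn I i) (toℕ-injective (trans (sym (+-identityʳ (toℕ i))) (sym j≡))) here
  path-up (suc g) i j lo≤i j≡ =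
    step (inj₁ (subst (Adjℕ (toℕ i)) (sym (toℕ-fromℕ< i+1<m)) (Adjℕ-suc (toℕ i) (≤-trans 1≤lo lo≤i))))
         (I-above k lo≤k) (path-up g k j lo≤k (trans j≡ (trans (+-suc (toℕ i) g) (cong (_+ g) (sym (toℕ-fromℕ< i+1<m))))))
    where
    i+1<m : suc (toℕ i) < m
    i+1<m = ≤-<-trans (≤-trans (s≤s (m≤m+n (toℕ i) g)) (≤-reflexive (trans (sym (+-suc (toℕ i) g)) (sym j≡)))) (toℕ<n j)
    k = fromℕ< i+1<m
    lo≤k : lo ≤ toℕ k
    lo≤k = subst (lo ≤_) (sym (toℕ-fromℕ< i+1<m)) (≤-trans lo≤i (n≤1+n _))

  interval-path : ∀ i j → lo ≤ toℕ i → lo ≤ toℕ j → PathIn I i j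
  interval-path i j lo≤i lo≤j with ≤-total (toℕ i) (toℕ j)
  ... | inj₁ i≤j = path-up (toℕ j ∸ toℕ i) i j lo≤i (sym (m+[n∸m]≡n i≤j))
  ... | inj₂ j≤i = path-reverse (I-above j lo≤j) (path-up (toℕ i ∸ toℕ j) j i lo≤j (sym (m+[n∸m]≡n j≤i)))

Count-≥2 : ∀ {m} {P : Word m → Set} {c} → Count P c → ∀ t₁ t₂ → P t₁ → P t₂ → ¬ (t₁ ≈W t₂) → 2 ≤ c
Count-≥2 (L , refl , _ , _ , cover) t₁ t₂ P₁ P₂ t₁≉t₂ with L | cover t₁ P₁ | cover t₂ P₂
... | y ∷ []     | here e₁ | here e₂ = ⊥-elim (t₁≉t₂ (trans (sym e₁) e₂))
... | y ∷ y′ ∷ _ | _       | _       = s≤s (s≤s z≤n)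

Count-≤1 : ∀ {m} {P : Word m → Set} {c} → Count P c → (∀ z z′ → P z → P z′ → z ≈W z′) → c ≤ 1
Count-≤1 (L , refl , P-all , distinct , _) unique with L | P-all | distinct
... | []         | _           | _                  = z≤n
... | y ∷ []     | _           | _                  = ≤-refl
... | y ∷ y′ ∷ _ | Py ∷ Py′ ∷ _ | (y≉y′ ∷ _) ∷ _    = ⊥-elim (y≉y′ (unique y y′ Py Py′))

-- Type D_{N+1} with J = S ∖ {s_N}

module TypeD (N : ℕ) (3≤N : 3 ≤ N) where

  private
    n : ℕ
    n = suc N

  2≤n : 2 ≤ n
  2≤n = s≤s (≤-trans (s≤s z≤n) 3≤N)

  open CoxeterRelations 2≤n

  infix 4 _≋_

  _≋_ : List ℕ → List ℕ → Set
  a ≋ b = ActEq n a b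

  Commute : ℕ → ℕ → Set
  Commute k l = k ∷ l ∷ [] ≋ l ∷ k ∷ []

  data Distant : ℕ → ℕ → Set where
    swaps : ∀ {i j} → suc i < j → Distant (suc i) (suc j)
    gen0  : ∀ {j} → 2 ≤ j → Distant 0 (suc j)

  distant-mono : ∀ {k l l′} → Distant k l → l ≤ l′ → Distant k l′
  distant-mono (swaps i+1<j) (s≤s j≤j′) = swaps (<-≤-trans i+1<j j≤j′)
  distant-mono (gen0 2≤j)    (s≤s j≤j′) = gen0 (≤-trans 2≤j j≤j′)

  distant⇒commute : ∀ {k l} → l < n → Distant k l → Commute k l
  distant⇒commute l<n (swaps i+1<j) = swaps-commute _ _ i+1<j l<n
  distant⇒commute l<n (gen0 2≤j)    = gen0-swap-commute _ 2≤j l<n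

  distant⇒commute˘ : ∀ {k l} → k < n → Distant l k → Commute k l
  distant⇒commute˘ k<n l~k = ≋-sym (distant⇒commute k<n l~k)

  commute-past : ∀ k w → All (Commute k) w → k ∷ w ≋ w ++ [ k ]
  commute-past k []      []       = ≋-reflexive refl
  commute-past k (l ∷ w) (c ∷ cs) = ≋-congʳ w c ⟫ ≋-congˡ [ l ] (commute-past k w cs)

  chain : ℕ → List ℕ
  chain p = ascending (suc p) (N ∸ p)

  chain-suc : ∀ p → p < N → chain p ≡ suc p ∷ chain (suc p)
  chain-suc p p<N rewrite ∸≡suc∸suc N p p<N = refl

  chain-top : chain N ≡ []
  chain-top rewrite n∸n≡0 N = refl

  length-chain : ∀ p → length (chain p) ≡ N ∸ p
  length-chain p = length-ascending (suc p) (N ∸ p)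

  ∈-chain⁻ : ∀ p {j} → j ∈ chain p → (p < j) × (j < n)
  ∈-chain⁻ p {j} j∈ with ∈-ascending⁻ (suc p) (N ∸ p) j∈ | p ≤? N
  ... | p<j , j<end | yes p≤N = p<j , subst (j <_) (cong suc (m+[n∸m]≡n p≤N)) j<end
  ... | p<j , j<end | no p≰N  =
    ⊥-elim (<⇒≱ p<j (≤-pred (≤-trans j<end (≤-reflexive (cong suc end≡p)))))
    where end≡p = trans (cong (_+_ p) (m≤n⇒m∸n≡0 (≰⇒≥ p≰N))) (+-identityʳ p)

  ∈-chain⁺ : ∀ p {j} → p < j → j < n → j ∈ chain p
  ∈-chain⁺ p {j} p<j j<n =
    ∈-ascending⁺ (suc p) (N ∸ p) p<j (subst (j <_) (cong suc (sym (m+[n∸m]≡n p≤N))) j<n)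
    where p≤N = <⇒≤ (<-≤-trans p<j (≤-pred j<n))

  chain-< : ∀ p → All (_< n) (chain p)
  chain-< p = All.tabulate (λ j∈ → proj₂ (∈-chain⁻ p j∈))

  chain-commute : ∀ {k} p → Distant k (suc p) → All (Commute k) (chain p)
  chain-commute p k~p = All.tabulate λ j∈ →
    distant⇒commute (proj₂ (∈-chain⁻ p j∈)) (distant-mono k~p (proj₁ (∈-chain⁻ p j∈)))

  2≤N : 2 ≤ N
  2≤N = ≤-trans (s≤s (s≤s z≤n)) 3≤N

  0<N : 0 < N
  0<N = ≤-trans (s≤s z≤n) 2≤N

  negChain : ℕ → List ℕ
  negChain zero    = 0 ∷ chain 1
  negChain (suc p) = suc p ∷ negChain p

  negChain-< : ∀ p → p < n → All (_< n) (negChain p)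
  negChain-< zero    p<n = p<n ∷ chain-< 1
  negChain-< (suc p) p<n = p<n ∷ negChain-< p (<-trans (n<1+n p) p<n)

  0∈negChain : ∀ p → 0 ∈ negChain p
  0∈negChain zero    = here refl
  0∈negChain (suc p) = there (0∈negChain p)

  1∈negChain : ∀ p → 1 ≤ p → 1 ∈ negChain p
  1∈negChain (suc zero)    _ = here refl
  1∈negChain (suc (suc p)) _ = there (1∈negChain (suc p) (s≤s z≤n))

  ∈-negChain : ∀ p {j} → 2 ≤ j → j < n → j ∈ negChain p
  ∈-negChain zero    2≤j j<n = there (∈-chain⁺ 1 2≤j j<n)
  ∈-negChain (suc p) 2≤j j<n = there (∈-negChain p 2≤j j<n)

  chain-braid : ∀ p → suc p < N → suc (suc p) ∷ chain p ≋ chain p ++ [ suc p ]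
  chain-braid p p+1<N rewrite chain-suc p (<-trans (n<1+n p) p+1<N) | chain-suc (suc p) p+1<N =
    ≋-congʳ (chain (suc (suc p))) (≋-sym (swaps-braid p (s≤s p+1<N))) ⟫
    ≋-congˡ (suc p ∷ suc (suc p) ∷ []) (commute-past (suc p) _ (chain-commute (suc (suc p)) (swaps ≤-refl)))

  chain-shift-by : ∀ d p j → j ≡ suc (d + p) → j < N → suc j ∷ chain p ≋ chain p ++ [ j ]
  chain-shift-by zero    p _ refl j<N = chain-braid p j<N
  chain-shift-by (suc d) p _ refl j<N rewrite chain-suc p (<-trans (s≤s (m≤n+m p (suc d))) j<N) =
    ≋-congʳ (chain (suc p)) (distant⇒commute˘ (s≤s j<N) (swaps (s≤s (s≤s (m≤n+m p d))))) ⟫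
    ≋-congˡ [ suc p ] (chain-shift-by d (suc p) _ (cong suc (sym (+-suc d p))) j<N)

  chain-shift : ∀ p j → p < j → j < N → suc j ∷ chain p ≋ chain p ++ [ j ]
  chain-shift p j p<j = chain-shift-by (j ∸ suc p) p j (trans (sym (m∸n+n≡m p<j)) (+-suc _ p))

  negChain-shift : ∀ p j → p < j → 2 ≤ j → j < N → suc j ∷ negChain p ≋ negChain p ++ [ j ]
  negChain-shift zero    j _   2≤j j<N =
    ≋-congʳ (chain 1) (distant⇒commute˘ (s≤s j<N) (gen0 2≤j)) ⟫
    ≋-congˡ [ 0 ] (chain-shift 1 j 2≤j j<N)
  negChain-shift (suc p) j p<j 2≤j j<N =
    ≋-congʳ (negChain p) (distant⇒commute˘ (s≤s j<N) (swaps p<j)) ⟫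
    ≋-congˡ [ suc p ] (negChain-shift p j (<-trans (n<1+n p) p<j) 2≤j j<N)

  negChain0-shift : 2 ∷ negChain 0 ≋ negChain 0 ++ [ 0 ]
  negChain0-shift rewrite chain-suc 1 2≤N =
    ≋-congʳ (chain 2) (≋-sym (gen0-gen2-braid (s≤s 2≤N))) ⟫
    ≋-congˡ (0 ∷ 2 ∷ []) (commute-past 0 (chain 2) (chain-commute 2 (gen0 ≤-refl)))

  negChain-fix : ∀ p i → 1 ≤ i → suc i < p → p < n → suc i ∷ negChain p ≋ negChain p ++ [ suc i ]
  negChain-fix (suc p) i 1≤i i+1<p+1 p+1<n with suc i ≟ p
  ... | yes refl =
    ≋-congʳ (negChain i) (swaps-braid i p+1<n) ⟫
    ≋-congˡ (suc (suc i) ∷ suc i ∷ []) (negChain-shift i (suc i) ≤-refl (s≤s 1≤i) (≤-pred p+1<n))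
  ... | no i+1≢p =
    ≋-congʳ (negChain p) (distant⇒commute p+1<n (swaps i+1<p)) ⟫
    ≋-congˡ [ suc p ] (negChain-fix p i 1≤i i+1<p (<-trans (n<1+n p) p+1<n))
    where i+1<p = ≤∧≢⇒< (≤-pred i+1<p+1) i+1≢p

  negChain-shift₁ : ∀ p → 2 ≤ p → p < n → 1 ∷ negChain p ≋ negChain p ++ [ 0 ]
  negChain-shift₁ (suc zero)          (s≤s ()) _
  negChain-shift₁ (suc (suc zero))    _ p<n rewrite chain-suc 1 2≤N =
    ≋-congʳ (0 ∷ 2 ∷ chain 2) (swaps-braid 0 p<n) ⟫
    ≋-congˡ (2 ∷ 1 ∷ []) (≋-congʳ (chain 2) (≋-sym (gen0-gen2-braid p<n))) ⟫
    ≋-congˡ (2 ∷ 1 ∷ 0 ∷ 2 ∷ []) (commute-past 0 (chain 2) (chain-commute 2 (gen0 ≤-refl)))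
  negChain-shift₁ (suc (suc (suc p))) _ p<n =
    ≋-congʳ (negChain (suc (suc p))) (distant⇒commute p<n (swaps (s≤s (s≤s z≤n)))) ⟫
    ≋-congˡ [ suc (suc (suc p)) ] (negChain-shift₁ (suc (suc p)) (s≤s (s≤s z≤n)) (<-trans (n<1+n _) p<n))

  negChain-shift₀ : ∀ p → 2 ≤ p → p < n → 0 ∷ negChain p ≋ negChain p ++ [ 1 ]
  negChain-shift₀ (suc zero)          (s≤s ()) _
  negChain-shift₀ (suc (suc zero))    _ p<n rewrite chain-suc 1 2≤N =
    ≋-congˡ (0 ∷ 2 ∷ []) (≋-congʳ (2 ∷ chain 2) (≋-sym (gen0-gen1-commute 1<n))) ⟫
    ≋-congʳ (1 ∷ 2 ∷ chain 2) (gen0-gen2-braid p<n) ⟫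
    ≋-congˡ (2 ∷ 0 ∷ []) (≋-congʳ (chain 2) (≋-sym (swaps-braid 0 p<n))) ⟫
    ≋-congˡ (2 ∷ 0 ∷ 1 ∷ 2 ∷ []) (commute-past 1 (chain 2) (chain-commute 2 (swaps ≤-refl))) ⟫
    ≋-congˡ [ 2 ] (≋-congʳ (2 ∷ (chain 2 ++ [ 1 ])) (gen0-gen1-commute 1<n))
    where 1<n = <-trans (s≤s (s≤s z≤n)) p<n
  negChain-shift₀ (suc (suc (suc p))) _ p<n =
    ≋-congʳ (negChain (suc (suc p))) (distant⇒commute p<n (gen0 (s≤s (s≤s z≤n)))) ⟫
    ≋-congˡ [ suc (suc (suc p)) ] (negChain-shift₀ (suc (suc p)) (s≤s (s≤s z≤n)) (<-trans (n<1+n _) p<n))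

  -- coset w = (p , σ) when w moves coordinate N to coordinate p with sign (−1)^σ (see coset-spec).
  SignedPos : Set
  SignedPos = ℕ × Bool

  Valid : SignedPos → Set
  Valid q = proj₁ q < n

  reflect : ℕ → SignedPos → SignedPos
  reflect k (p , σ) = pos k p , neg k (pos k p) xor σ

  start : SignedPos
  start = N , false

  coset : List ℕ → SignedPos
  coset = foldr reflect start

  rep : SignedPos → List ℕ
  rep (p , false) = chain p
  rep (p , true)  = negChain p

  rank : SignedPos → ℕ
  rank (p , false) = N ∸ p
  rank (p , true)  = N + p

  record Exchange (k : ℕ) (q q′ : SignedPos) : Set where
    constructor exchanged
    field
      leftover      : List ℕ
      ≋-rep         : k ∷ rep q ≋ rep q′ ++ leftover
      leftover-from : All (λ j → j ≡ k ⊎ j ∈ rep q) leftover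
      leftover-J    : All (_< N) leftover

  exchange-[] : ∀ {k q q′} → k ∷ rep q ≋ rep q′ → Exchange k q q′
  exchange-[] {q′ = q′} e = exchanged [] (e ⟫ ≋-++-[] (rep q′)) [] []

  exchange-gen0 : ∀ q → Valid q → Exchange 0 q (reflect 0 q)
  exchange-gen0 (zero , false) _ =
    exchange-[] (≋-reflexive (cong (0 ∷_) (chain-suc 0 0<N)) ⟫ ≋-congʳ (chain 1) (gen0-gen1-commute 2≤n))
  exchange-gen0 (zero , true)  _ = exchange-[] (≋-congʳ (chain 1) (gen-involutive 0 0<m))
  exchange-gen0 (suc zero , false) _ = exchange-[] (≋-reflexive refl)
  exchange-gen0 (suc zero , true) 1<n =
    exchange-[] (≋-congʳ (0 ∷ chain 1) (gen0-gen1-commute 1<n) ⟫ ≋-congˡ [ 1 ] (≋-congʳ (chain 1) (gen-involutive 0 0<m))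
                 ⟫ ≋-reflexive (sym (chain-suc 0 0<N)))
  exchange-gen0 (suc (suc p) , false) _ =
    exchanged [ 0 ] (commute-past 0 (chain (suc (suc p))) (chain-commute _ (gen0 (s≤s (s≤s z≤n)))))
      (inj₁ refl ∷ []) (0<N ∷ [])
  exchange-gen0 (suc (suc p) , true) p<n =
    exchanged [ 1 ] (negChain-shift₀ (suc (suc p)) (s≤s (s≤s z≤n)) p<n)
      (inj₂ (1∈negChain _ (s≤s z≤n)) ∷ []) (2≤N ∷ [])

  exchange-fixed-chain : ∀ j p → suc j < n → p < n → p ≢ j → p ≢ suc j → Exchange (suc j) (p , false) (p , false)
  exchange-fixed-chain j p sj<n p<n p≢j p≢sj with suc p ≤? j
  ... | yes p<j =
    exchanged [ j ] (chain-shift p j p<j (≤-pred sj<n))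
      (inj₂ (∈-chain⁺ p p<j (<-trans (n<1+n j) sj<n)) ∷ []) (≤-pred sj<n ∷ [])
  ... | no p≮j  =
    exchanged [ suc j ] (commute-past (suc j) (chain p) (chain-commute p (swaps sj<p)))
      (inj₁ refl ∷ []) (<-≤-trans sj<p (≤-pred p<n) ∷ [])
    where sj<p = ≤∧≢⇒< (≤∧≢⇒< (≤-pred (≰⇒> p≮j)) (p≢j ∘′ sym)) (p≢sj ∘′ sym)

  exchange-fixed-negChain : ∀ j p → suc j < n → p < n → p ≢ j → p ≢ suc j → Exchange (suc j) (p , true) (p , true)
  exchange-fixed-negChain zero p _ p<n p≢0 p≢1 =
    exchanged [ 0 ] (negChain-shift₁ p 2≤p p<n) (inj₂ (0∈negChain p) ∷ []) (0<N ∷ [])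
    where 2≤p = ≤∧≢⇒< (≤∧≢⇒< z≤n (p≢0 ∘′ sym)) (p≢1 ∘′ sym)
  exchange-fixed-negChain (suc zero) zero _ _ _ _ =
    exchanged [ 0 ] negChain0-shift (inj₂ (here refl) ∷ []) (0<N ∷ [])
  exchange-fixed-negChain (suc zero) (suc zero)       _ _ p≢1 _ = ⊥-elim (p≢1 refl)
  exchange-fixed-negChain (suc zero) (suc (suc zero)) _ _ _ p≢2 = ⊥-elim (p≢2 refl)
  exchange-fixed-negChain (suc zero) (suc (suc (suc p))) _ p<n _ _ =
    exchanged [ 2 ] (negChain-fix _ 1 ≤-refl (s≤s (s≤s (s≤s z≤n))) p<n)
      (inj₁ refl ∷ []) (<-≤-trans (s≤s (s≤s (s≤s z≤n))) (≤-pred p<n) ∷ [])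
  exchange-fixed-negChain (suc (suc j)) p ssj<n p<n p≢j p≢sj with suc p ≤? suc (suc j)
  ... | yes p<j =
    exchanged [ suc (suc j) ] (negChain-shift p (suc (suc j)) p<j (s≤s (s≤s z≤n)) (≤-pred ssj<n))
      (inj₂ (∈-negChain p (s≤s (s≤s z≤n)) (<-trans (n<1+n _) ssj<n)) ∷ []) (≤-pred ssj<n ∷ [])
  ... | no p≮j  =
    exchanged [ suc (suc (suc j)) ] (negChain-fix p (suc (suc j)) (s≤s z≤n) sj<p p<n)
      (inj₁ refl ∷ []) (<-≤-trans sj<p (≤-pred p<n) ∷ [])
    where sj<p = ≤∧≢⇒< (≤∧≢⇒< (≤-pred (≰⇒> p≮j)) (p≢j ∘′ sym)) (p≢sj ∘′ sym)

  exchange-swap : ∀ j q → suc j < n → Valid q → Exchange (suc j) q (reflect (suc j) q)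
  exchange-swap j (p , σ) sj<n p<n with p ≟ j
  exchange-swap j (p , false) sj<n _ | yes refl rewrite pos-suc-self p =
    exchange-[] (≋-reflexive (cong (suc p ∷_) (chain-suc p (≤-pred sj<n))) ⟫ ≋-congʳ (chain (suc p)) (gen-involutive (suc p) sj<n))
  exchange-swap j (p , true)  _    _ | yes refl rewrite pos-suc-self p = exchange-[] (≋-reflexive refl)
  ... | no p≢j with p ≟ suc j
  exchange-swap j (p , false) sj<n _ | no _ | yes refl rewrite pos-suc-suc j =
    exchange-[] (≋-reflexive (sym (chain-suc j (≤-pred sj<n))))
  exchange-swap j (p , true)  sj<n _ | no _ | yes refl rewrite pos-suc-suc j =
    exchange-[] (≋-congʳ (negChain j) (gen-involutive (suc j) sj<n))
  exchange-swap j (p , false) sj<n p<n | no p≢j | no p≢sj rewrite pos-suc-other j p p≢j p≢sj =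
    exchange-fixed-chain j p sj<n p<n p≢j p≢sj
  exchange-swap j (p , true)  sj<n p<n | no p≢j | no p≢sj rewrite pos-suc-other j p p≢j p≢sj =
    exchange-fixed-negChain j p sj<n p<n p≢j p≢sj

  exchange : ∀ k q → k < n → Valid q → Exchange k q (reflect k q)
  exchange zero    q _    = exchange-gen0 q
  exchange (suc j) q sj<n = exchange-swap j q sj<n

  reflect-valid : ∀ k q → k < n → Valid q → Valid (reflect k q)
  reflect-valid k (p , σ) k<n p<n = pos-< k p 2≤n k<n p<n

  coset-valid : ∀ w → All (_< n) w → Valid (coset w)
  coset-valid []      []           = n<1+n N
  coset-valid (k ∷ w) (k<n ∷ w<n) = reflect-valid k (coset w) k<n (coset-valid w w<n)

  coset-spec : ∀ w → (word-pos w (proj₁ (coset w)) ≡ N) × (word-neg w (proj₁ (coset w)) ≡ proj₂ (coset w))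
  coset-spec []      = refl , refl
  coset-spec (k ∷ w) with coset-spec w
  ... | pos≡N , neg≡σ =
    trans (cong (word-pos w) (pos-involutive k _)) pos≡N ,
    cong (neg k (pos k (proj₁ (coset w))) xor_) (trans (cong (word-neg w) (pos-involutive k _)) neg≡σ)

  word-pos-injective : ∀ w {a b} → word-pos w a ≡ word-pos w b → a ≡ b
  word-pos-injective []      e = e
  word-pos-injective (k ∷ w) {a} {b} e =
    trans (sym (pos-involutive k a)) (trans (cong (pos k) (word-pos-injective w e)) (pos-involutive k b))

  coset-resp-act : ∀ a b → All (_< n) a → All (_< n) b → act a (base n) ≡ act b (base n) → coset a ≡ coset b
  coset-resp-act a b a<n b<n e with act-base-injective 2≤n a<n b<n e (proj₁ (coset a)) (coset-valid a a<n)
  ... | pos≡ , neg≡ = cong₂ _,_ p≡ (begin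
      proj₂ (coset a)                ≡⟨ proj₂ (coset-spec a) ⟨
      word-neg a (proj₁ (coset a))   ≡⟨ neg≡ ⟩
      word-neg b (proj₁ (coset a))   ≡⟨ cong (word-neg b) p≡ ⟩
      word-neg b (proj₁ (coset b))   ≡⟨ proj₂ (coset-spec b) ⟩
      proj₂ (coset b)                ∎)
    where
    open ≡-Reasoning
    p≡ : proj₁ (coset a) ≡ proj₁ (coset b)
    p≡ = word-pos-injective b (trans (sym pos≡) (trans (proj₁ (coset-spec a)) (sym (proj₁ (coset-spec b)))))

  rank-reflect : ∀ k q → rank (reflect k q) ≤ suc (rank q)
  rank-reflect zero (zero , false)          = ≤-reflexive (+-comm N 1)
  rank-reflect zero (zero , true)           = ≤-trans (m∸n≤m N 1) (≤-trans (m≤m+n N 0) (n≤1+n _))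
  rank-reflect zero (suc zero , false)      = ≤-trans (≤-reflexive (+-identityʳ N)) (m∸n≤1+m∸[1+n] N 0)
  rank-reflect zero (suc zero , true)       = ≤-trans (m≤m+n N 1) (n≤1+n _)
  rank-reflect zero (suc (suc p) , false)   = n≤1+n _
  rank-reflect zero (suc (suc p) , true)    = n≤1+n _
  rank-reflect (suc j) (p , σ) with p ≟ j
  rank-reflect (suc j) (p , false) | yes refl rewrite pos-suc-self p = ≤-trans (∸-monoʳ-≤ N (n≤1+n p)) (n≤1+n _)
  rank-reflect (suc j) (p , true)  | yes refl rewrite pos-suc-self p = ≤-reflexive (+-suc N p)
  ... | no p≢j with p ≟ suc j
  rank-reflect (suc j) (p , false) | no _ | yes refl rewrite pos-suc-suc j = m∸n≤1+m∸[1+n] N j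
  rank-reflect (suc j) (p , true)  | no _ | yes refl rewrite pos-suc-suc j =
    ≤-trans (+-monoʳ-≤ N (n≤1+n j)) (n≤1+n _)
  rank-reflect (suc j) (p , false) | no p≢j | no p≢sj rewrite pos-suc-other j p p≢j p≢sj = n≤1+n _
  rank-reflect (suc j) (p , true)  | no p≢j | no p≢sj rewrite pos-suc-other j p p≢j p≢sj = n≤1+n _

  length-rep : ∀ q → length (rep q) ≡ rank q
  length-rep (p , false)    = length-chain p
  length-rep (zero , true)  = trans (cong suc (length-chain 1)) (trans (sym (∸≡suc∸suc N 0 0<N)) (sym (+-identityʳ N)))
  length-rep (suc p , true) = trans (cong suc (length-rep (p , true))) (sym (+-suc N p))

  module Decomposition (P : ℕ → Set) (R : SignedPos → Set) (R-start : R start)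
    (R-reflect : ∀ k q → R q → P k → k < n → R (reflect k q))
    (R-rep : ∀ q → R q → All P (rep q)) (R-valid : ∀ q → R q → Valid q) where

    coset-invariant : ∀ w → All P w → All (_< n) w → R (coset w)
    coset-invariant []      []         []           = R-start
    coset-invariant (k ∷ w) (Pk ∷ Pw) (k<n ∷ w<n) =
      R-reflect k (coset w) (coset-invariant w Pw w<n) Pk k<n

    record Decomposed (w : List ℕ) : Set where
      field
        leftover   : List ℕ
        ≋-rep      : w ≋ rep (coset w) ++ leftover
        leftover-P : All P leftover
        leftover-J : All (_< N) leftover

    decompose : ∀ w → All P w → All (_< n) w → Decomposed w
    decompose []      []         []           = record
      { leftover = [] ; ≋-rep = ≋-reflexive (cong (_++ []) (sym chain-top)) ; leftover-P = [] ; leftover-J = [] }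
    decompose (k ∷ w) (Pk ∷ Pw) (k<n ∷ w<n) = record
      { leftover   = E.leftover ++ D.leftover
      ; ≋-rep      = ≋-congˡ [ k ] D.≋-rep ⟫ ≋-congʳ D.leftover E.≋-rep ⟫
                     ≋-reflexive (++-assoc (rep (coset (k ∷ w))) E.leftover D.leftover)
      ; leftover-P = All.++⁺ (All.map from-P E.leftover-from) D.leftover-P
      ; leftover-J = All.++⁺ E.leftover-J D.leftover-J
      }
      where
      module D = Decomposed (decompose w Pw w<n)
      Rq = coset-invariant w Pw w<n
      module E = Exchange (exchange k (coset w) k<n (R-valid _ Rq))
      from-P : ∀ {j} → j ≡ k ⊎ j ∈ rep (coset w) → P j
      from-P (inj₁ refl) = Pk
      from-P (inj₂ j∈)   = All.lookup (R-rep _ Rq) j∈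

  reflect-start : ∀ k → k < N → reflect k start ≡ start
  reflect-start zero    k<N rewrite pos-0-other N 2≤N | neg-0-other N 2≤N = refl
  reflect-start (suc j) k<N rewrite pos-suc-other j N (<⇒≢ (<-trans (n<1+n j) k<N) ∘′ sym) (<⇒≢ k<N ∘′ sym) = refl

  coset-J : ∀ y → All (_< N) y → coset y ≡ start
  coset-J []      []           = refl
  coset-J (k ∷ y) (k<N ∷ y<N) = trans (cong (reflect k) (coset-J y y<N)) (reflect-start k k<N)

  coset-++-J : ∀ a y → All (_< N) y → coset (a ++ y) ≡ coset a
  coset-++-J a y y<N = trans (foldr-++ reflect start a y) (cong (λ q → foldr reflect q a) (coset-J y y<N))

  indices : Word n → List ℕ
  indices = map toℕ

  indices-< : ∀ w → All (_< n) (indices w)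
  indices-< w = All.map⁺ (All.tabulate {xs = w} λ {i} _ → toℕ<n i)

  ≈W⇒act≡ : ∀ u v → u ≈W v → act (indices u) (base n) ≡ act (indices v) (base n)
  ≈W⇒act≡ u v u≈v = trans (sym (⟦⟧≡act u)) (trans u≈v (⟦⟧≡act v))

  cosetOf : Word n → SignedPos
  cosetOf w = coset (indices w)

  cosetOf-resp : ∀ u v → u ≈W v → cosetOf u ≡ cosetOf v
  cosetOf-resp u v u≈v = coset-resp-act (indices u) (indices v) (indices-< u) (indices-< v) (≈W⇒act≡ u v u≈v)

  cosetOf-valid : ∀ w → Valid (cosetOf w)
  cosetOf-valid w = coset-valid (indices w) (indices-< w)

  J⇒<N : ∀ i → Jset n i → toℕ i < N
  J⇒<N i i≢N = ≤∧≢⇒< (≤-pred (toℕ<n i)) i≢N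

  cosetOf-++-J : ∀ u x → All (Jset n) x → cosetOf (u ++ x) ≡ cosetOf u
  cosetOf-++-J u x Jx = trans (cong coset (map-++ toℕ u x))
    (coset-++-J (indices u) (indices x) (All.map⁺ (All.map (λ {i} → J⇒<N i) Jx)))

  rank-cosetOf≤length : ∀ w → rank (cosetOf w) ≤ length w
  rank-cosetOf≤length []      = ≤-reflexive (n∸n≡0 N)
  rank-cosetOf≤length (k ∷ w) = ≤-trans (rank-reflect (toℕ k) (cosetOf w)) (s≤s (rank-cosetOf≤length w))

  rank≤Len : ∀ v {a} → Len v a → rank (cosetOf v) ≤ a
  rank≤Len v ((r , r≈v , refl) , _) = subst (λ q → rank q ≤ length r) (cosetOf-resp r v r≈v) (rank-cosetOf≤length r)

  Tight : Word n → Set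
  Tight w = rank (cosetOf w) ≡ length w

  tight⇒Len : ∀ r w → r ≈W w → Tight r → Len w (length r)
  tight⇒Len r w r≈w tight = (r , r≈w , refl) , λ r′ r′≈w → begin
    length r             ≡⟨ tight ⟨
    rank (cosetOf r)     ≡⟨ cong rank (cosetOf-resp r r′ (trans r≈w (sym r′≈w))) ⟩
    rank (cosetOf r′)    ≤⟨ rank-cosetOf≤length r′ ⟩
    length r′            ∎
    where open ≤-Reasoning

  tight⇒MinRep : ∀ t → Tight t → MinRep (Jset n) t
  tight⇒MinRep t tight x Jx a b (_ , a≤) Lb = begin
    a                        ≤⟨ a≤ t refl ⟩
    length t                 ≡⟨ tight ⟨
    rank (cosetOf t)         ≡⟨ cong rank (cosetOf-++-J t x Jx) ⟨
    rank (cosetOf (t ++ x))  ≤⟨ rank≤Len (t ++ x) Lb ⟩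
    b                        ∎
    where open ≤-Reasoning

  rep-< : ∀ q → Valid q → All (_< n) (rep q)
  rep-< (p , false) _   = chain-< p
  rep-< (p , true)  p<n = negChain-< p p<n

  act-reverse : ∀ y (z : Vec ℤ n) → All (_< n) y → act y (act (reverse y) z) ≡ z
  act-reverse []      z []           = refl
  act-reverse (k ∷ y) z (k<n ∷ y<n) = begin
    act₁ k (act y (act (reverse (k ∷ y)) z))   ≡⟨ cong (λ w → act₁ k (act y (act w z))) (unfold-reverse k y) ⟩
    act₁ k (act y (act (reverse y ++ [ k ]) z)) ≡⟨ cong (λ v → act₁ k (act y v)) (act-++ (reverse y) [ k ] z) ⟩
    act₁ k (act y (act (reverse y) (act₁ k z))) ≡⟨ cong (act₁ k) (act-reverse y (act₁ k z) y<n) ⟩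
    act₁ k (act₁ k z)                           ≡⟨ act-≡ (gen-involutive k k<n) z ⟩
    z                                           ∎
    where open ≡-Reasoning

  fromIndices : ∀ y → All (_< n) y → Word n
  fromIndices []      []           = []
  fromIndices (k ∷ y) (k<n ∷ y<n) = fromℕ< k<n ∷ fromIndices y y<n

  indices-fromIndices : ∀ y y<n → indices (fromIndices y y<n) ≡ y
  indices-fromIndices []      []           = refl
  indices-fromIndices (k ∷ y) (k<n ∷ y<n) = cong₂ _∷_ (toℕ-fromℕ< k<n) (indices-fromIndices y y<n)

  All-fromIndices : ∀ {Q : ℕ → Set} y y<n → All Q y → All (λ i → Q (toℕ i)) (fromIndices y y<n)
  All-fromIndices []      []           []         = []
  All-fromIndices {Q} (k ∷ y) (k<n ∷ y<n) (Qk ∷ Qy) = subst Q (sym (toℕ-fromℕ< k<n)) Qk ∷ All-fromIndices y y<n Qy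

  module Maximality (P : ℕ → Set) (R : SignedPos → Set) (R-start : R start)
    (R-reflect : ∀ k q → R q → P k → k < n → R (reflect k q))
    (R-rep : ∀ q → R q → All P (rep q)) (R-valid : ∀ q → R q → Valid q)
    (K : Fin n → Set) (PJ⇒K : ∀ i → P (toℕ i) → toℕ i < N → K i) where

    open Decomposition P R R-start R-reflect R-rep R-valid public

    -- Write x = rep q · y with y in W_J; then u y⁻¹ is a K-extension of u equal to rep q, whose length is rank q.
    minRep-length≤rank : ∀ u x → All (λ i → P (toℕ i)) x → x ≈W u → MinRep K u → ∀ {a} → Len u a →
      a ≤ rank (cosetOf x)
    minRep-length≤rank u x Px x≈u u-min {a} La =
      ≤-trans (u-min x⁻ K-x⁻ a (length r) La (tight⇒Len r (u ++ x⁻) r≈ux⁻ tight-r)) (≤-reflexive length-r)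
      where
      q = cosetOf x
      Rq = coset-invariant (indices x) (All.map⁺ Px) (indices-< x)
      module D = Decomposed (decompose (indices x) (All.map⁺ Px) (indices-< x))
      y = D.leftover
      y<n = All.map (λ k<N → <-trans k<N (n<1+n N)) D.leftover-J
      x⁻ = reverse (fromIndices y y<n)
      indices-x⁻ : indices x⁻ ≡ reverse y
      indices-x⁻ = trans (reverse-map toℕ (fromIndices y y<n)) (cong reverse (indices-fromIndices y y<n))
      K-x⁻ : All K x⁻
      K-x⁻ = All-reverse (All.zipWith (λ (Pi , i<N) → PJ⇒K _ Pi i<N)
               (All-fromIndices y y<n D.leftover-P , All-fromIndices y y<n D.leftover-J))
      r = fromIndices (rep q) (rep-< q (R-valid q Rq))
      length-r : length r ≡ rank q
      length-r = trans (sym (length-map toℕ r)) (trans (cong length (indices-fromIndices (rep q) _)) (length-rep q))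
      J-x⁻ : All (Jset n) x⁻
      J-x⁻ = All-reverse (All.map (λ i<N → <⇒≢ i<N) (All-fromIndices y y<n D.leftover-J))
      r≈ux⁻ : r ≈W (u ++ x⁻)
      r≈ux⁻ = sym (begin
        ⟦ u ++ x⁻ ⟧                            ≡⟨ ⟦⟧≡act (u ++ x⁻) ⟩
        act (indices (u ++ x⁻)) (base n)       ≡⟨ cong (λ w → act w (base n)) (map-++ toℕ u x⁻) ⟩
        act (indices u ++ indices x⁻) (base n) ≡⟨ act-++ (indices u) (indices x⁻) (base n) ⟩
        act (indices u) z                      ≡⟨ act-≡ x≋u z ⟨
        act (indices x) z                      ≡⟨ act-≡ D.≋-rep z ⟩
        act (rep q ++ y) z                     ≡⟨ act-++ (rep q) y z ⟩
        act (rep q) (act y z)                  ≡⟨ cong (λ w → act (rep q) (act y (act w (base n)))) indices-x⁻ ⟩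
        act (rep q) (act y (act (reverse y) (base n))) ≡⟨ cong (act (rep q)) (act-reverse y (base n) y<n) ⟩
        act (rep q) (base n)                   ≡⟨ cong (λ w → act w (base n)) (indices-fromIndices (rep q) _) ⟨
        act (indices r) (base n)               ≡⟨ ⟦⟧≡act r ⟨
        ⟦ r ⟧                                  ∎)
        where
        open ≡-Reasoning
        z = act (indices x⁻) (base n)
        x≋u = ActEq-from-base 2≤n (indices-< x) (indices-< u) (≈W⇒act≡ x u x≈u)
      tight-r : Tight r
      tight-r = begin
        rank (cosetOf r)         ≡⟨ cong rank (cosetOf-resp r (u ++ x⁻) r≈ux⁻) ⟩
        rank (cosetOf (u ++ x⁻)) ≡⟨ cong rank (cosetOf-++-J u x⁻ J-x⁻) ⟩
        rank (cosetOf u)         ≡⟨ cong rank (cosetOf-resp u x (sym x≈u)) ⟩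
        rank q                   ≡⟨ length-r ⟨
        length r                 ∎
        where open ≡-Reasoning

  minRep-length≡rank : ∀ v {a} → MinRep (Jset n) v → Len v a → a ≡ rank (cosetOf v)
  minRep-length≡rank v v-min La = ≤-antisym (minRep-length≤rank v v (All.tabulate λ {i} _ → toℕ<n i) refl v-min La) (rank≤Len v La)
    where
    open Maximality (_< n) Valid (n<1+n N) (λ k q Vq _ k<n → reflect-valid k q k<n Vq) rep-< (λ _ Vq → Vq)
                    (Jset n) (λ i _ i<N → <⇒≢ i<N)

  tight-tail : ∀ k w → Tight (k ∷ w) → Tight w × (rank (cosetOf (k ∷ w)) ≡ suc (rank (cosetOf w)))
  tight-tail k w tight = tight-w , trans tight (cong suc (sym tight-w))
    where
    tight-w : Tight w
    tight-w = ≤-antisym (rank-cosetOf≤length w)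
      (≤-pred (subst (_≤ suc (rank (cosetOf w))) tight (rank-reflect (toℕ k) (cosetOf w))))

  reflect-onto-chain : ∀ k p → reflect k (suc p , false) ≡ (p , false) → k ≡ suc p
  reflect-onto-chain zero    zero    ()
  reflect-onto-chain zero    (suc p) e = ⊥-elim (1+n≢n (cong proj₁ e))
  reflect-onto-chain (suc j) p e with suc p ≟ j
  ... | yes refl rewrite pos-suc-self (suc p) = ⊥-elim (2+p≢p (cong proj₁ e))
    where
    2+p≢p : suc (suc p) ≢ p
    2+p≢p ()
  ... | no sp≢j with suc p ≟ suc j
  ...   | yes refl = refl
  ...   | no sp≢sj rewrite pos-suc-other j (suc p) sp≢j sp≢sj = ⊥-elim (1+n≢n (cong proj₁ e))

  reflect-1-onto-neg0 : ∀ k → reflect k (1 , false) ≡ (0 , true) → k ≡ 0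
  reflect-1-onto-neg0 zero                _ = refl
  reflect-1-onto-neg0 (suc zero)          ()
  reflect-1-onto-neg0 (suc (suc zero))    ()
  reflect-1-onto-neg0 (suc (suc (suc j))) ()

  reflect-0-onto-neg : ∀ k p → reflect k (0 , false) ≡ (p , true) → k ≡ 0
  reflect-0-onto-neg zero         p _ = refl
  reflect-0-onto-neg (suc zero)    p ()
  reflect-0-onto-neg (suc (suc j)) p ()

  reflect-neg0-onto-neg : ∀ k p → reflect k (0 , true) ≡ (p , true) → 1 ≤ p → k ≡ 1
  reflect-neg0-onto-neg zero          p ()   _
  reflect-neg0-onto-neg (suc zero)    p _    _ = refl
  reflect-neg0-onto-neg (suc (suc j)) p refl ()

  tight⇒chain : ∀ w p → Tight w → cosetOf w ≡ (p , false) → indices w ≡ chain p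
  tight⇒chain []      p _     refl = sym chain-top
  tight⇒chain (k ∷ w) p tight e with cosetOf w in e-w | tight-tail k w tight | cosetOf-valid w
  ... | p′ , true  | _ , rank≡ | _ =
    ⊥-elim (<⇒≱ (s≤s (m≤m+n N p′)) (subst (_≤ N) (trans (sym (cong rank e)) rank≡) (m∸n≤m N p)))
  ... | p′ , false | tight-w , rank≡ | p′<n =
    trans (cong₂ _∷_ k≡ (tight⇒chain w (suc p) (trans (cong rank e-w) tight-w) (trans e-w (cong (_, false) p′≡)))) (sym (chain-suc p p<N))
    where
    p≤N : p ≤ N
    p≤N = ≤-pred (subst Valid e (reflect-valid (toℕ k) (p′ , false) (toℕ<n k) p′<n))
    p′≡ : p′ ≡ suc p
    p′≡ = 1+[m∸o]≡m∸n⇒o≡1+n N p p′ p≤N (≤-pred p′<n) (trans (sym rank≡) (cong rank e))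
    p<N : p < N
    p<N = subst (_≤ N) p′≡ (≤-pred p′<n)
    k≡ : toℕ k ≡ suc p
    k≡ = reflect-onto-chain (toℕ k) p (subst (λ z → reflect (toℕ k) (z , false) ≡ (p , false)) p′≡ e)

  tight⇒negChain0 : ∀ w → Tight w → cosetOf w ≡ (0 , true) → indices w ≡ 0 ∷ chain 1
  tight⇒negChain0 (k ∷ w) tight e with cosetOf w in e-w | tight-tail k w tight | cosetOf-valid w
  ... | p′ , true  | _ , rank≡ | _ =
    ⊥-elim (<⇒≱ (s≤s (m≤m+n N p′)) (≤-reflexive (trans (sym rank≡) (trans (cong rank e) (+-identityʳ N)))))
  ... | p′ , false | tight-w , rank≡ | p′<n =
    cong₂ _∷_ (reflect-1-onto-neg0 (toℕ k) (subst (λ z → reflect (toℕ k) (z , false) ≡ (0 , true)) p′≡1 e))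
              (tight⇒chain w 1 (trans (cong rank e-w) tight-w) (trans e-w (cong (_, false) p′≡1)))
    where
    p′≡1 : p′ ≡ 1
    p′≡1 = 1+[m∸o]≡m∸n⇒o≡1+n N 0 p′ z≤n (≤-pred p′<n) (trans (sym rank≡) (trans (cong rank e) (+-identityʳ N)))

  indices-∷⁻ : ∀ w {j c} → indices w ≡ j ∷ c → Σ (Fin n) λ a → Σ (Word n) λ β → (w ≡ a ∷ β) × (toℕ a ≡ j) × (indices β ≡ c)
  indices-∷⁻ (a ∷ β) e = a , β , refl , ∷-injective e

  record Ends01 (w : Word n) : Set where
    constructor ends01
    field
      prefix : Word n
      b a    : Fin n
      β      : Word n
      w≡     : w ≡ prefix ++ b ∷ a ∷ β
      β≡     : indices β ≡ chain 1
      a,b    : (toℕ a ≡ 0 × toℕ b ≡ 1) ⊎ (toℕ a ≡ 1 × toℕ b ≡ 0)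

  tight⇒ends01 : ∀ w p → Tight w → 1 ≤ p → cosetOf w ≡ (p , true) → Ends01 w
  tight⇒ends01 (k ∷ w) p tight 1≤p e with cosetOf w in e-w | tight-tail k w tight
  ... | zero , false | tight-w , _ with indices-∷⁻ w (trans (tight⇒chain w 0 (trans (cong rank e-w) tight-w) e-w) (chain-suc 0 0<N))
  ...   | a , β , refl , a≡1 , β≡ = ends01 [] k a β refl β≡ (inj₂ (a≡1 , reflect-0-onto-neg (toℕ k) p e))
  tight⇒ends01 (k ∷ w) p tight 1≤p e | zero , true | tight-w , _ with indices-∷⁻ w (tight⇒negChain0 w (trans (cong rank e-w) tight-w) e-w)
  ...   | a , β , refl , a≡0 , β≡ = ends01 [] k a β refl β≡ (inj₁ (a≡0 , reflect-neg0-onto-neg (toℕ k) p e 1≤p))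
  tight⇒ends01 (k ∷ w) p tight 1≤p e | suc x , false | _ , rank≡ =
    ⊥-elim (<⇒≱ (m<m+n N 1≤p) (begin
      N + p                  ≡⟨ cong rank e ⟨
      rank (reflect (toℕ k) (suc x , false)) ≡⟨ rank≡ ⟩
      suc (N ∸ suc x)        ≤⟨ s≤s (∸-monoʳ-≤ N (s≤s z≤n)) ⟩
      suc (N ∸ 1)            ≡⟨ ∸≡suc∸suc N 0 0<N ⟨
      N                      ∎))
    where open ≤-Reasoning
  tight⇒ends01 (k ∷ w) p tight 1≤p e | suc x , true | tight-w , _ with tight⇒ends01 w (suc x) (trans (cong rank e-w) tight-w) (s≤s z≤n) e-w
  ...   | ends01 α b a β refl β≡ a,b = ends01 (k ∷ α) b a β refl β≡ a,b

  coset-chain-by : ∀ g p → g + p ≡ N → coset (chain p) ≡ (p , false)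
  coset-chain-by zero    p p≡N = subst (λ z → coset (chain z) ≡ (z , false)) (sym p≡N) (cong coset chain-top)
  coset-chain-by (suc g) p e   = begin
    coset (chain p)                          ≡⟨ cong coset (chain-suc p (≤-trans (s≤s (m≤n+m p g)) (≤-reflexive e))) ⟩
    reflect (suc p) (coset (chain (suc p)))  ≡⟨ cong (reflect (suc p)) (coset-chain-by g (suc p) (trans (+-suc g p) e)) ⟩
    reflect (suc p) (suc p , false)          ≡⟨ cong (_, false) (pos-suc-suc p) ⟩
    p , false                                ∎
    where open ≡-Reasoning

  coset-chain : ∀ p → p ≤ N → coset (chain p) ≡ (p , false)
  coset-chain p p≤N = coset-chain-by (N ∸ p) p (m∸n+n≡m p≤N)

  ≤-pos-suc : ∀ j p p′ → p ≤ j → p ≤ p′ → p ≤ pos (suc j) p′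
  ≤-pos-suc j p p′ p≤j p≤p′ with p′ ≡ᵇ j
  ... | true  = ≤-trans p≤j (n≤1+n j)
  ... | false with p′ ≡ᵇ suc j
  ...   | true  = p≤j
  ...   | false = p≤p′

  -- Cosets of negative sign have rank at least N, so z has positive sign.
  minRep-below-N⇒chain : ∀ z i → i < N → MinRep (Jset n) z → Len z i →
    Σ (Word n) λ rz → (rz ≈W z) × (indices rz ≡ chain (N ∸ i))
  minRep-below-N⇒chain z i i<N z-min Lz with cosetOf z in e | minRep-length≡rank z z-min Lz | cosetOf-valid z
  ... | x , true  | i≡N+x | _ = ⊥-elim (<⇒≱ i<N (subst (N ≤_) (sym i≡N+x) (m≤m+n N x)))
  ... | x , false | i≡N∸x | x<n = rz , rz≈z , trans (tight⇒chain rz x tight-rz (trans (cosetOf-resp rz z rz≈z) e)) (cong chain x≡)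
    where
    rz = proj₁ (proj₁ Lz)
    rz≈z = proj₁ (proj₂ (proj₁ Lz))
    tight-rz : Tight rz
    tight-rz = trans (cong rank (trans (cosetOf-resp rz z rz≈z) e)) (trans (sym i≡N∸x) (sym (proj₂ (proj₂ (proj₁ Lz)))))
    x≡ : x ≡ N ∸ i
    x≡ = trans (sym (m∸[m∸n]≡n (≤-pred x<n))) (cong (N ∸_) (sym i≡N∸x))

  minRep-unique-below-N : ∀ {i} → i < N → ∀ z z′ → MinRep (Jset n) z → Len z i → MinRep (Jset n) z′ → Len z′ i → z ≈W z′
  minRep-unique-below-N {i} i<N z z′ z-min Lz z′-min Lz′
    with minRep-below-N⇒chain z i i<N z-min Lz | minRep-below-N⇒chain z′ i i<N z′-min Lz′
  ... | rz , rz≈z , e | rz′ , rz′≈z′ , e′ =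
    trans (sym rz≈z) (trans (cong ⟦_⟧ (map-injective toℕ-injective (trans e (sym e′)))) rz′≈z′)

  node2 : Fin n
  node2 = fromℕ< (s≤s 2≤N)

  toℕ-node2 : toℕ node2 ≡ 2
  toℕ-node2 = toℕ-fromℕ< (s≤s 2≤N)

  connected-via-2 : ∀ {I : Fin n → Set} lo → 1 ≤ lo → lo ≤ 2 → (∀ i → lo ≤ toℕ i → I i) →
    (∀ i → I i → toℕ i ≡ 0 ⊎ lo ≤ toℕ i) → Connected I
  connected-via-2 {I} lo 1≤lo lo≤2 I-above I-shape i j Ii Ij with I-shape i Ii | I-shape j Ij
  ... | inj₂ lo≤i | inj₂ lo≤j = interval-path i j lo≤i lo≤j
    where open Interval I lo 1≤lo I-above
  ... | inj₁ i≡0  | inj₁ j≡0  = subst (PathIn I i) (toℕ-injective (trans i≡0 (sym j≡0))) here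
  ... | inj₁ i≡0  | inj₂ lo≤j =
    step (inj₁ (inj₁ (i≡0 , toℕ-node2))) (I-above node2 lo≤2′) (interval-path node2 j lo≤2′ lo≤j)
    where
    open Interval I lo 1≤lo I-above
    lo≤2′ = subst (lo ≤_) (sym toℕ-node2) lo≤2
  ... | inj₂ lo≤i | inj₁ j≡0  =
    interval-path i node2 lo≤i lo≤2′ ++ᴾ step (inj₂ (inj₁ (j≡0 , toℕ-node2))) Ij here
    where
    open Interval I lo 1≤lo I-above
    lo≤2′ = subst (lo ≤_) (sym toℕ-node2) lo≤2

  rank-reflect-01 : ∀ k → k ≡ 0 ⊎ k ≡ 1 → rank (reflect k (1 , false)) ≡ N
  rank-reflect-01 _ (inj₁ refl) = +-identityʳ N
  rank-reflect-01 _ (inj₂ refl) = refl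

  module ReducedWordOf (v : Word n) (v-min : MinRep (Jset n) v) (r : Word n) (r≈v : r ≈W v) (r-red : Reduced r) where

    I : Fin n → Set
    I i = i ∈ r

    Maximal : Set
    Maximal = ∀ (u : Word n) → InParabolic I u → MinRep (λ i → I i × Jset n i) u →
      ∀ a b → Len u a → Len v b → a ≤ b

    Len-r : Len v (length r)
    Len-r = (r , r≈v , refl) , λ r′ r′≈v → r-red r′ (trans r′≈v (sym r≈v))

    r-tight : Tight r
    r-tight = trans (cong rank (cosetOf-resp r v r≈v)) (sym (minRep-length≡rank v v-min Len-r))

    cosetOf-r : cosetOf r ≡ cosetOf v
    cosetOf-r = cosetOf-resp r v r≈v

    ∈-indices⁻ : ∀ i → toℕ i ∈ indices r → I i
    ∈-indices⁻ i i∈ with ∈-map⁻ toℕ i∈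
    ... | j , j∈r , i≡j = subst (_∈ r) (sym (toℕ-injective i≡j)) j∈r

    maximal-from-invariant : (R : SignedPos → Set) → R start →
      (∀ k q → R q → k ∈ indices r → k < n → R (reflect k q)) →
      (∀ q → R q → All (_∈ indices r) (rep q)) → (∀ q → R q → Valid q) →
      (∀ q → R q → rank q ≤ rank (cosetOf v)) → Maximal
    maximal-from-invariant R R-start R-reflect R-rep R-valid R-rank u (x , Ix , x≈u) u-min a b La Lb = begin
      a                  ≤⟨ minRep-length≤rank u x Px x≈u u-min La ⟩
      rank (cosetOf x)   ≤⟨ R-rank _ (coset-invariant (indices x) (All.map⁺ Px) (indices-< x)) ⟩
      rank (cosetOf v)   ≡⟨ minRep-length≡rank v v-min Lb ⟨
      b                  ∎
      where
      open ≤-Reasoning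
      open Maximality (_∈ indices r) R R-start R-reflect R-rep R-valid
                      (λ i → I i × Jset n i) (λ i i∈ i<N → ∈-indices⁻ i i∈ , <⇒≢ i<N)
      Px = All.map (∈-map⁺ toℕ) Ix

    chain-case : ∀ p → cosetOf v ≡ (p , false) → Connected I × Maximal
    chain-case p e = connected , maximal-from-invariant R R-start R-reflect R-rep (λ _ → proj₂ ∘′ proj₂) R-rank
      where
      r≡ : indices r ≡ chain p
      r≡ = tight⇒chain r p r-tight (trans cosetOf-r e)
      ∈r⇒> : ∀ {k} → k ∈ indices r → p < k
      ∈r⇒> k∈ = proj₁ (∈-chain⁻ p (subst (_ ∈_) r≡ k∈))
      >⇒∈r : ∀ i → suc p ≤ toℕ i → I i
      >⇒∈r i p<i = ∈-indices⁻ i (subst (toℕ i ∈_) (sym r≡) (∈-chain⁺ p p<i (toℕ<n i)))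
      connected : Connected I
      connected i j Ii Ij = interval-path i j (∈r⇒> (∈-map⁺ toℕ Ii)) (∈r⇒> (∈-map⁺ toℕ Ij))
        where open Interval I (suc p) (s≤s z≤n) >⇒∈r
      R : SignedPos → Set
      R q = (proj₂ q ≡ false) × (p ≤ proj₁ q) × Valid q
      R-start : R start
      R-start = refl , ≤-pred (subst Valid e (cosetOf-valid v)) , n<1+n N
      R-reflect : ∀ k q → R q → k ∈ indices r → k < n → R (reflect k q)
      R-reflect zero    _          _                     0∈  _    = ⊥-elim (<⇒≱ (∈r⇒> 0∈) z≤n)
      R-reflect (suc j) (p′ , _) (refl , p≤p′ , p′<n) sj∈ sj<n =
        refl , ≤-pos-suc j p p′ (≤-pred (∈r⇒> sj∈)) p≤p′ , reflect-valid (suc j) (p′ , false) sj<n p′<n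
      R-rep : ∀ q → R q → All (_∈ indices r) (rep q)
      R-rep (p′ , _) (refl , p≤p′ , _) = All.tabulate λ {j} j∈ →
        subst (j ∈_) (sym r≡) (∈-chain⁺ p (≤-<-trans p≤p′ (proj₁ (∈-chain⁻ p′ j∈))) (proj₂ (∈-chain⁻ p′ j∈)))
      R-rank : ∀ q → R q → rank q ≤ rank (cosetOf v)
      R-rank (p′ , _) (refl , p≤p′ , _) = ≤-trans (∸-monoʳ-≤ N p≤p′) (≤-reflexive (cong rank (sym e)))

    negChain0-case : cosetOf v ≡ (0 , true) → Connected I × Maximal
    negChain0-case e = connected-via-2 2 (s≤s z≤n) ≤-refl ≥2⇒∈r shape ,
                       maximal-from-invariant R R-start R-reflect R-rep R-valid R-rank
      where
      r≡ : indices r ≡ 0 ∷ chain 1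
      r≡ = tight⇒negChain0 r r-tight (trans cosetOf-r e)
      ∈r⇒ : ∀ k → k ∈ indices r → k ≡ 0 ⊎ 2 ≤ k
      ∈r⇒ k k∈ with subst (k ∈_) r≡ k∈
      ... | here k≡0  = inj₁ k≡0
      ... | there k∈′ = inj₂ (proj₁ (∈-chain⁻ 1 k∈′))
      ≥2⇒∈r : ∀ i → 2 ≤ toℕ i → I i
      ≥2⇒∈r i 2≤i = ∈-indices⁻ i (subst (toℕ i ∈_) (sym r≡) (there (∈-chain⁺ 1 2≤i (toℕ<n i))))
      shape : ∀ i → I i → toℕ i ≡ 0 ⊎ 2 ≤ toℕ i
      shape i Ii = ∈r⇒ (toℕ i) (∈-map⁺ toℕ Ii)
      R : SignedPos → Set
      R q = ((proj₂ q ≡ false) × (1 ≤ proj₁ q) × Valid q) ⊎ (q ≡ (0 , true))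
      R-start : R start
      R-start = inj₁ (refl , 0<N , n<1+n N)
      R-reflect : ∀ k q → R q → k ∈ indices r → k < n → R (reflect k q)
      R-reflect zero    (suc zero , _)    (inj₁ (refl , _ , _))      _ _ = inj₂ refl
      R-reflect zero    (suc (suc p′) , _) (inj₁ (refl , _ , p′<n))  _ _ = inj₁ (refl , s≤s z≤n , p′<n)
      R-reflect zero    (zero , true)     (inj₂ refl)                _ _ = inj₁ (refl , ≤-refl , 2≤n)
      R-reflect (suc j) (p′ , _)          (inj₁ (refl , 1≤p′ , p′<n)) sj∈ sj<n with ∈r⇒ (suc j) sj∈
      ... | inj₂ 2≤sj = inj₁ (refl , ≤-pos-suc j 1 p′ (≤-pred 2≤sj) 1≤p′ , reflect-valid (suc j) (p′ , false) sj<n p′<n)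
      R-reflect (suc j) (zero , true)     (inj₂ refl)                sj∈ _ with ∈r⇒ (suc j) sj∈
      ... | inj₂ (s≤s 1≤j) rewrite pos-suc-other j 0 (<⇒≢ 1≤j) (λ ()) = inj₂ refl
      R-rep : ∀ q → R q → All (_∈ indices r) (rep q)
      R-rep (p′ , _) (inj₁ (refl , 1≤p′ , _)) = All.tabulate λ {j} j∈ →
        subst (j ∈_) (sym r≡) (there (∈-chain⁺ 1 (≤-<-trans 1≤p′ (proj₁ (∈-chain⁻ p′ j∈))) (proj₂ (∈-chain⁻ p′ j∈))))
      R-rep (zero , true) (inj₂ refl) = All.tabulate λ {j} j∈ → subst (j ∈_) (sym r≡) j∈
      R-valid : ∀ q → R q → Valid q
      R-valid _             (inj₁ (_ , _ , q-valid)) = q-valid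
      R-valid (zero , true) (inj₂ refl)             = s≤s z≤n
      R-rank : ∀ q → R q → rank q ≤ rank (cosetOf v)
      R-rank (p′ , _)      (inj₁ (refl , _ , _)) = subst (λ q → N ∸ p′ ≤ rank q) (sym e) (≤-trans (m∸n≤m N p′) (m≤m+n N 0))
      R-rank (zero , true) (inj₂ refl)           = ≤-reflexive (cong rank (sym e))

    ends01⇒all-in : Ends01 r → ∀ j → j < n → j ∈ indices r
    ends01⇒all-in (ends01 prefix b a β r≡ β≡ a,b) = all-in
      where
      in-suffix : ∀ {j} → j ∈ toℕ b ∷ toℕ a ∷ indices β → j ∈ indices r
      in-suffix {j} j∈ = subst (j ∈_) (sym (trans (cong indices r≡) (map-++ toℕ prefix (b ∷ a ∷ β))))
                               (∈-++⁺ʳ (indices prefix) j∈)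
      0,1-in : (toℕ a ≡ 0 × toℕ b ≡ 1) ⊎ (toℕ a ≡ 1 × toℕ b ≡ 0) → (0 ∈ indices r) × (1 ∈ indices r)
      0,1-in (inj₁ (a≡0 , b≡1)) = in-suffix (there (here (sym a≡0))) , in-suffix (here (sym b≡1))
      0,1-in (inj₂ (a≡1 , b≡0)) = in-suffix (here (sym b≡0)) , in-suffix (there (here (sym a≡1)))
      all-in : ∀ j → j < n → j ∈ indices r
      all-in zero          _   = proj₁ (0,1-in a,b)
      all-in (suc zero)    _   = proj₂ (0,1-in a,b)
      all-in (suc (suc j)) j<n = in-suffix (there (there (subst (_ ∈_) (sym β≡) (∈-chain⁺ 1 (s≤s (s≤s z≤n)) j<n))))

    full-case : cosetOf v ≡ (N , true) → Connected I × Maximal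
    full-case e = connected-via-2 1 ≤-refl (s≤s z≤n) (λ i _ → I-all i) (λ i _ → shape (toℕ i)) ,
                  maximal-from-invariant Valid (n<1+n N) (λ k q Vq _ k<n → reflect-valid k q k<n Vq)
                    (λ q Vq → All.map (λ {j} j<n → all-in j j<n) (rep-< q Vq)) (λ _ Vq → Vq) R-rank
      where
      all-in : ∀ j → j < n → j ∈ indices r
      all-in = ends01⇒all-in (tight⇒ends01 r N r-tight (≤-trans (s≤s z≤n) 2≤N) (trans cosetOf-r e))
      I-all : ∀ i → I i
      I-all i = ∈-indices⁻ i (all-in (toℕ i) (toℕ<n i))
      shape : ∀ k → k ≡ 0 ⊎ 1 ≤ k
      shape zero    = inj₁ refl
      shape (suc k) = inj₂ (s≤s z≤n)
      R-rank : ∀ q → Valid q → rank q ≤ rank (cosetOf v)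
      R-rank (p′ , false) _   = subst (λ q → N ∸ p′ ≤ rank q) (sym e) (≤-trans (m∸n≤m N p′) (m≤m+n N N))
      R-rank (p′ , true)  p′<n = subst (λ q → N + p′ ≤ rank q) (sym e) (+-monoʳ-≤ N (≤-pred p′<n))

    tight-subword⇒Coeff : ∀ t → Tight t → t ⊆ r → Coeff v (length t) t
    tight-subword⇒Coeff t tight t⊆r = tight⇒MinRep t tight , (r , r≈v , r-red , t , t⊆r , refl) , tight⇒Len t t refl tight

    ends01⇒Count-at-N-≥2 : Ends01 r → ∀ {c} → Count (Coeff v N) c → 2 ≤ c
    ends01⇒Count-at-N-≥2 (ends01 prefix b a β r≡ β≡ a,b) count =
      Count-≥2 count (a ∷ β) (b ∷ β) (coeff a a01 (subst (a ∷ β ⊆_) (sym r≡) (++⁺ˡ prefix (b ∷ʳ ⊆-refl))))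
                                     (coeff b b01 (subst (b ∷ β ⊆_) (sym r≡) (++⁺ˡ prefix (refl ∷ (a ∷ʳ ⊆-refl)))))
                                     distinct
      where
      a01 : toℕ a ≡ 0 ⊎ toℕ a ≡ 1
      a01 = Sum.map proj₁ proj₁ a,b
      b01 : toℕ b ≡ 0 ⊎ toℕ b ≡ 1
      b01 = Sum.swap (Sum.map proj₂ proj₂ a,b)
      coset-β : cosetOf β ≡ (1 , false)
      coset-β = trans (cong coset β≡) (coset-chain 1 (≤-trans (s≤s z≤n) 2≤N))
      length-kβ : ∀ k → length (k ∷ β) ≡ N
      length-kβ k = trans (cong suc (trans (sym (length-map toℕ β)) (trans (cong length β≡) (length-chain 1))))
                          (sym (∸≡suc∸suc N 0 0<N))
      coeff : ∀ k → toℕ k ≡ 0 ⊎ toℕ k ≡ 1 → k ∷ β ⊆ r → Coeff v N (k ∷ β)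
      coeff k k01 kβ⊆r = subst (λ i → Coeff v i (k ∷ β)) (length-kβ k) (tight-subword⇒Coeff (k ∷ β) tight kβ⊆r)
        where
        tight : Tight (k ∷ β)
        tight = trans (cong (λ q → rank (reflect (toℕ k) q)) coset-β) (trans (rank-reflect-01 (toℕ k) k01) (sym (length-kβ k)))
      reflects-differ : ∀ a b → (a ≡ 0 × b ≡ 1) ⊎ (a ≡ 1 × b ≡ 0) → reflect a (1 , false) ≢ reflect b (1 , false)
      reflects-differ _ _ (inj₁ (refl , refl)) ()
      reflects-differ _ _ (inj₂ (refl , refl)) ()
      distinct : ¬ ((a ∷ β) ≈W (b ∷ β))
      distinct aβ≈bβ = reflects-differ (toℕ a) (toℕ b) a,b (begin
        reflect (toℕ a) (1 , false)   ≡⟨ cong (reflect (toℕ a)) coset-β ⟨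
        cosetOf (a ∷ β)               ≡⟨ cosetOf-resp (a ∷ β) (b ∷ β) aβ≈bβ ⟩
        cosetOf (b ∷ β)               ≡⟨ cong (reflect (toℕ b)) coset-β ⟩
        reflect (toℕ b) (1 , false)   ∎)
        where open ≡-Reasoning

    Count-below-N-≤1 : ∀ {i c} → i < N → Count (Coeff v i) c → c ≤ 1
    Count-below-N-≤1 i<N count =
      Count-≤1 count λ z z′ (z-min , _ , Lz) (z′-min , _ , Lz′) → minRep-unique-below-N i<N z z′ z-min Lz z′-min Lz′

    -- Palindromicity pairs the coefficient of q^p, at most 1, with that of q^N, at least 2.
    middle-case : Palindromic v → ∀ p → 1 ≤ p → p < N → cosetOf v ≡ (p , true) → ⊥
    middle-case (d , Ld , symmetric , _ , _) p 1≤p p<N e =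
      let (c , count-p , count-d∸p) = symmetric p (subst (p ≤_) (sym d≡N+p) (m≤n+m p N)) in
      <⇒≱ (ends01⇒Count-at-N-≥2 (tight⇒ends01 r p r-tight 1≤p (trans cosetOf-r e))
              (subst (λ i → Count (Coeff v i) c) (trans (cong (_∸ p) d≡N+p) (m+n∸n≡m N p)) count-d∸p))
          (Count-below-N-≤1 p<N count-p)
      where
      d≡N+p : d ≡ N + p
      d≡N+p = trans (minRep-length≡rank v v-min Ld) (cong rank e)

mainTheorem8 : (n : ℕ) → 4 ≤ n → (v : Word n) →
    MinRep (Jset n) v → Palindromic v → LocallyLongest (Jset n) v
mainTheorem8 (suc N) (s≤s 3≤N) v v-min pal r r≈v r-red =
  proj₁ connected×maximal , (r , All.tabulate id , r≈v) , (λ x IJx → v-min x (All.map proj₂ IJx)) , proj₂ connected×maximal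
  where
  open TypeD N 3≤N
  open ReducedWordOf v v-min r r≈v r-red
  connected×maximal : Connected I × Maximal
  connected×maximal with cosetOf v in e | cosetOf-valid v
  ... | p , false    | _   = chain-case p e
  ... | zero , true  | _   = negChain0-case e
  ... | suc p , true | p<n with suc p ≟ N
  ...   | yes p+1≡N = full-case (trans e (cong (_, true) p+1≡N))
  ...   | no p+1≢N  = ⊥-elim (middle-case pal (suc p) (s≤s z≤n) (≤∧≢⇒< (≤-pred p<n) p+1≢N) e)
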